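{- Let $n\geq 3$, $l\geq 2$, let $H=K_{2n}\circ_{n}K_{2n}\circ_{n}\cdots\circ_{n}K_{2n}$ ($l$ copies of $K_{2n}$), let $e$ be an edge of $H$ neither of whose endpoints lies in the common clique $C$, and let $G=H\setminus\{e\}$. Then the spectrum of $\epsilon(G)$ consists of: (1) $-1$ with multiplicity at least $n-1$; (2) $-2$ with multiplicity at least $1$; (3) $0$ with multiplicity at least $(n-3)+(n-1)(l-1)$; (4) $-2n$ with multiplicity at least $l-2$; (5) the roots of the polynomial $$x^{4}-(2nl-3n+1)x^{3}-(2n-2nl+3ln^{2}+2)x^{2}+(4n-12ln+2ln^{2}+2ln^{3}+4n^{2}-4n^{3})x+16n-24n^{2}+8n^{3}-16ln+16ln^{2}-4ln^{3}.$$
   Context: All graphs are finite, simple and connected. $d(u,v)$ is the distance and $e(v)=\max_u d(u,v)$ the eccentricity. The eccentricity matrix $\epsilon(G)$ has $(u,v)$ entry $d(u,v)$ if $d(u,v)=\min\{e(u),e(v)\}$ and $0$ otherwise. The graph $K_{2n}\circ_{n}\cdots\circ_{n}K_{2n}$ ($l$ copies) has vertex set $C\cup P_1\cup\cdots\cup P_l$ (disjoint), $|C|=|P_i|=n$, each $C\cup P_i$ induces a complete graph, and no edges between $P_i$ and $P_j$ for $i\ne j$; $C$ is the common (identified) clique. $H\setminus\{e\}$ is $H$ with edge $e$ removed. -}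

module Defs where

open import Data.Nat as ℕ using (ℕ; zero; suc; _⊔_; _⊓_)
open import Data.Integer as ℤ using (ℤ; +_; -_)
open import Data.Fin as Fin using (Fin; zero; suc; punchIn; remQuot)
open import Data.Bool using (Bool; true; false; if_then_else_; _∨_; _∧_; not)
open import Data.Product using (proj₁; proj₂)
open import Relation.Nullary.Decidable using (⌊_⌋)
open import Function using (_∘_)

-- Generic graph notions on vertex set Fin m, adjacency given as a
-- Bool-valued (symmetric, irreflexive) relation.

anyFin : ∀ m → (Fin m → Bool) → Bool
anyFin zero    f = false
anyFin (suc m) f = f zero ∨ anyFin m (f ∘ suc)

maxFin : ∀ m → (Fin m → ℕ) → ℕ
maxFin zero    f = 0
maxFin (suc m) f = f zero ⊔ maxFin m (f ∘ suc)

reach : ∀ {m} → (Fin m → Fin m → Bool) → ℕ → Fin m → Fin m → Bool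
reach A zero    u v = ⌊ u Fin.≟ v ⌋
reach {m} A (suc k) u v = reach A k u v ∨ anyFin m (λ w → reach A k u w ∧ A w v)

-- least k < fuel with f k = true (fuel if none)
leastTrue : ℕ → (ℕ → Bool) → ℕ
leastTrue zero       f = 0
leastTrue (suc fuel) f = if f 0 then 0 else suc (leastTrue fuel (f ∘ suc))

-- distance d(u,v): least k such that v is reachable from u by a walk of
-- length ≤ k (correct for connected graphs on m vertices, where d < m)
dist : ∀ {m} → (Fin m → Fin m → Bool) → Fin m → Fin m → ℕ
dist {m} A u v = leastTrue m (λ k → reach A k u v)

ecc : ∀ {m} → (Fin m → Fin m → Bool) → Fin m → ℕ
ecc {m} A u = maxFin m (dist A u)

eccMatrix : ∀ {m} → (Fin m → Fin m → Bool) → Fin m → Fin m → ℤ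
eccMatrix A u v =
  if ⌊ dist A u v ℕ.≟ (ecc A u ⊓ ecc A v) ⌋ then + dist A u v else + 0

sumFin : ∀ m → (Fin m → ℤ) → ℤ
sumFin zero    f = + 0
sumFin (suc m) f = f zero ℤ.+ sumFin m (f ∘ suc)

sgn : ℕ → ℤ
sgn zero    = + 1
sgn (suc k) = - sgn k

det : ∀ m → (Fin m → Fin m → ℤ) → ℤ
det zero    M = + 1
det (suc m) M =
  sumFin (suc m) (λ j → sgn (Fin.toℕ j) ℤ.* M zero j ℤ.*
                          det m (λ i k → M (suc i) (punchIn j k)))

charPolyAt : ∀ {m} → (Fin m → Fin m → ℤ) → ℤ → ℤ
charPolyAt {m} M x =
  det m (λ i j → (if ⌊ i Fin.≟ j ⌋ then x else + 0) ℤ.- M i j)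

-- The graph H = K_{2n} ∘_n ... ∘_n K_{2n} (l copies) on Fin (suc l * n).
-- Vertex v ↦ (block, position) via remQuot; block 0 is the common
-- clique C, block (suc b) is P_{b+1}.

block : ∀ l n → Fin (suc l ℕ.* n) → Fin (suc l)
block l n v = proj₁ (remQuot {suc l} n v)

pos : ∀ l n → Fin (suc l ℕ.* n) → Fin n
pos l n v = proj₂ (remQuot {suc l} n v)

isC : ∀ {k} → Fin (suc k) → Bool
isC zero    = true
isC (suc _) = false

adjH : ∀ n l → Fin (suc l ℕ.* n) → Fin (suc l ℕ.* n) → Bool
adjH n l u v =
  not ⌊ u Fin.≟ v ⌋ ∧
  (isC (block l n u) ∨ isC (block l n v) ∨ ⌊ block l n u Fin.≟ block l n v ⌋)

isVertex : ∀ n l → Fin l → Fin n → Fin (suc l ℕ.* n) → Bool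
isVertex n l b p u = ⌊ block l n u Fin.≟ suc b ⌋ ∧ ⌊ pos l n u Fin.≟ p ⌋

adjG : ∀ n l → Fin l → Fin n → Fin n →
       Fin (suc l ℕ.* n) → Fin (suc l ℕ.* n) → Bool
adjG n l b p q u v =
  adjH n l u v ∧
  not ((isVertex n l b p u ∧ isVertex n l b q v) ∨
       (isVertex n l b q u ∧ isVertex n l b p v))

quartic : ℕ → ℕ → ℤ → ℤ
quartic n' l' x =
  x ℤ.^ 4
  ℤ.- (+ 2 ℤ.* n ℤ.* l ℤ.- + 3 ℤ.* n ℤ.+ + 1) ℤ.* x ℤ.^ 3
  ℤ.- (+ 2 ℤ.* n ℤ.- + 2 ℤ.* n ℤ.* l ℤ.+ + 3 ℤ.* l ℤ.* n ℤ.^ 2 ℤ.+ + 2) ℤ.* x ℤ.^ 2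
  ℤ.+ (+ 4 ℤ.* n ℤ.- + 12 ℤ.* l ℤ.* n ℤ.+ + 2 ℤ.* l ℤ.* n ℤ.^ 2
       ℤ.+ + 2 ℤ.* l ℤ.* n ℤ.^ 3 ℤ.+ + 4 ℤ.* n ℤ.^ 2 ℤ.- + 4 ℤ.* n ℤ.^ 3) ℤ.* x
  ℤ.+ + 16 ℤ.* n ℤ.- + 24 ℤ.* n ℤ.^ 2 ℤ.+ + 8 ℤ.* n ℤ.^ 3
  ℤ.- + 16 ℤ.* l ℤ.* n ℤ.+ + 16 ℤ.* l ℤ.* n ℤ.^ 2 ℤ.- + 4 ℤ.* l ℤ.* n ℤ.^ 3
  where
  n = + n'
  l = + l'

-- In G = H ∖ e every vertex of C is adjacent to all others and any two vertices have a common
-- neighbour in C, so C has eccentricity 1, every other vertex eccentricity 2, and an entry of ε(G)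
-- only depends on which of the l + 3 classes {p}, {q}, C, the rest of the block of e, and the other
-- blocks its two vertices lie in. For a class map κ, a matrix δ_uv λ(κ u) + ω_u B(κ u, κ v) has
-- determinant ∏_c λ_c ^ (|κ⁻¹ c| - 1) · det (δ_cd λ_c + W_c B_cd) with W_c = ∑_{κ u = c} ω_u:
-- subtracting the column of one vertex from that of another vertex of its class, and adding the
-- corresponding rows, peels off a factor λ_c and merges the two vertices. Applied to x I - ε(G) this
-- reduces to the l + 3 classes, and applied once more to the four groups {p, q}, C, the rest of the
-- block of e, and the other blocks, leaving a 4 × 4 determinant that is the quartic.

module Submission where

open import Defs
open import Algebra.Bundles using (CommutativeMonoid; Semiring)
open import Data.Nat as ℕ using (ℕ; zero; suc; _≤_; z≤n; s≤s; _∸_; _⊓_)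
import Data.Nat.Properties as ℕ
open import Data.Integer using (ℤ; +_; -_; _+_; _-_; _*_; _^_)
import Data.Integer.Properties as ℤ
open import Data.Integer.Tactic.RingSolver using (solve-∀)
open import Data.Fin as Fin using (Fin; zero; suc; punchIn; punchOut; toℕ; _≟_; _↑ˡ_; _↑ʳ_; combine)
import Data.Fin.Properties as Fin
open import Data.Bool using (Bool; true; false; if_then_else_; _∨_; _∧_; not)
import Data.Bool.Properties as Bool
open import Data.Product using (∃; _,_; proj₁; proj₂; _×_)
open import Data.Empty using (⊥-elim)
open import Relation.Nullary.Decidable using (Dec; ⌊_⌋; yes; no; ¬?; _×-dec_; isYes≗does; dec-true; dec-false)
open import Relation.Nullary.Negation using (¬_)
open import Relation.Binary.PropositionalEquality
open import Function using (_∘_)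
open import Function.Definitions using (Injective; StrictlySurjective)

open ≡-Reasoning

-- Finite sums

module CommutativeMonoidSum {c ℓ} (M : CommutativeMonoid c ℓ) where
  open CommutativeMonoid M
    using (Carrier; _≈_; _∙_; ε; ∙-cong; ∙-congˡ; identityˡ; identityʳ; assoc)
    renaming (refl to ≈-refl; sym to ≈-sym; trans to ≈-trans)
  open import Algebra.Properties.CommutativeMonoid.Sum M

  sum-zero : ∀ {m} (f : Fin m → Carrier) → (∀ i → f i ≈ ε) → sum f ≈ ε
  sum-zero {m} f f≈ε = ≈-trans (sum-cong-≋ f≈ε) (sum-replicate-zero m)

  sum-single : ∀ {m} (f : Fin m → Carrier) i → (∀ j → j ≢ i → f j ≈ ε) → sum f ≈ f i
  sum-single {suc m} f i f≈ε = ≈-trans (sum-remove f)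
    (≈-trans (∙-congˡ (sum-zero _ (λ t → f≈ε (punchIn i t) (Fin.punchInᵢ≢i i t)))) (identityʳ (f i)))

  sum-factorAt : ∀ {m} (f g : Fin m → Carrier) i x → (∀ j → j ≢ i → f j ≈ g j) → f i ≈ x ∙ g i →
    sum f ≈ x ∙ sum g
  sum-factorAt {suc m} f g i x f≈g fi≈x∙gi = ≈-trans (sum-remove f)
    (≈-trans (∙-cong fi≈x∙gi (sum-cong-≋ (λ t → f≈g (punchIn i t) (Fin.punchInᵢ≢i i t))))
    (≈-trans (assoc x (g i) _) (∙-congˡ (≈-sym (sum-remove g)))))

  sum-splitAt : ∀ m {n} (f : Fin (m ℕ.+ n) → Carrier) → sum f ≈ sum (λ i → f (i ↑ˡ n)) ∙ sum (λ j → f (m ↑ʳ j))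
  sum-splitAt zero    f = ≈-sym (identityˡ _)
  sum-splitAt (suc m) f = ≈-trans (∙-congˡ (sum-splitAt m (f ∘ suc))) (≈-sym (assoc _ _ _))

  sum-combine : ∀ m {n} (f : Fin (m ℕ.* n) → Carrier) → sum f ≈ sum (λ i → sum (λ j → f (combine {m} {n} i j)))
  sum-combine zero        f = ≈-refl
  sum-combine (suc m) {n} f = ≈-trans (sum-splitAt n f) (∙-congˡ (sum-combine m (f ∘ (n ↑ʳ_))))

open import Algebra.Properties.Semiring.Sum ℤ.+-*-semiring
  using (sum; sum-syntax; sum-cong-≗; sum-remove; ∑-comm; ∑-distrib-+; *-distribˡ-sum)
open CommutativeMonoidSum (Semiring.+-commutativeMonoid ℤ.+-*-semiring)
module ℕΣ where
  open import Algebra.Properties.CommutativeMonoid.Sum ℕ.+-0-commutativeMonoid public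
  open CommutativeMonoidSum ℕ.+-0-commutativeMonoid public
open import Algebra.Properties.CommutativeMonoid.Sum ℤ.*-1-commutativeMonoid
  using () renaming (sum to product; sum-cong-≗ to product-cong)
open CommutativeMonoidSum ℤ.*-1-commutativeMonoid using () renaming (sum-zero to product-one; sum-factorAt to product-factorAt)

-- Determinants

Matrix : ℕ → Set
Matrix m = Fin m → Fin m → ℤ

minor : ∀ {m} → Matrix (suc m) → Fin (suc m) → Fin (suc m) → Matrix m
minor A i j r t = A (punchIn i r) (punchIn j t)

_ᵀ : ∀ {m} → Matrix m → Matrix m
(A ᵀ) i j = A j i

sumFin≡sum : ∀ m (f : Fin m → ℤ) → sumFin m f ≡ sum f
sumFin≡sum zero    f = refl
sumFin≡sum (suc m) f = cong (_+_ (f zero)) (sumFin≡sum m (f ∘ suc))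

det-expandRow₀ : ∀ m (A : Matrix (suc m)) →
  det (suc m) A ≡ ∑[ j < suc m ] (sgn (toℕ j) * A zero j * det m (minor A zero j))
det-expandRow₀ m A = sumFin≡sum (suc m) (λ j → sgn (toℕ j) * A zero j * det m (minor A zero j))

det-cong : ∀ m {A B : Matrix m} → (∀ i j → A i j ≡ B i j) → det m A ≡ det m B
det-cong zero    A≡B = refl
det-cong (suc m) {A} {B} A≡B = begin
  det (suc m) A                                                      ≡⟨ det-expandRow₀ m A ⟩
  ∑[ j < suc m ] (sgn (toℕ j) * A zero j * det m (minor A zero j))  ≡⟨ sum-cong-≗ term ⟩
  ∑[ j < suc m ] (sgn (toℕ j) * B zero j * det m (minor B zero j))  ≡⟨ det-expandRow₀ m B ⟨
  det (suc m) B                                                      ∎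
  where
  term : ∀ j → sgn (toℕ j) * A zero j * det m (minor A zero j) ≡ sgn (toℕ j) * B zero j * det m (minor B zero j)
  term j = cong₂ (λ a d → sgn (toℕ j) * a * d) (A≡B zero j) (det-cong m (λ r t → A≡B (suc r) (punchIn j t)))

sgn-+ : ∀ a b → sgn (a ℕ.+ b) ≡ sgn a * sgn b
sgn-+ zero    b = sym (ℤ.*-identityˡ (sgn b))
sgn-+ (suc a) b = trans (cong -_ (sgn-+ a b)) (ℤ.neg-distribˡ-* (sgn a) (sgn b))

neg-*-neg : ∀ a b → - a * - b ≡ a * b
neg-*-neg = solve-∀

sgn-*-sgn : ∀ a → sgn a * sgn a ≡ + 1
sgn-*-sgn zero    = refl
sgn-*-sgn (suc a) = trans (neg-*-neg (sgn a) (sgn a)) (sgn-*-sgn a)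

-- pivot c t is the index of column c once column punchIn c t has been deleted
pivot : ∀ {m} → Fin (suc (suc m)) → Fin (suc m) → Fin (suc m)
pivot zero          t       = zero
pivot (suc c)       zero    = c
pivot {suc m} (suc c) (suc t) = suc (pivot c t)

punchIn-pivot : ∀ {m} (c : Fin (suc (suc m))) t → punchIn (punchIn c t) (pivot c t) ≡ c
punchIn-pivot zero          t       = refl
punchIn-pivot (suc c)       zero    = refl
punchIn-pivot {suc m} (suc c) (suc t) = cong suc (punchIn-pivot c t)

punchIn-punchIn-pivot : ∀ {m} (c : Fin (suc (suc m))) t (τ : Fin m) →
  punchIn (punchIn c t) (punchIn (pivot c t) τ) ≡ punchIn c (punchIn t τ)
punchIn-punchIn-pivot zero          t       τ       = refl
punchIn-punchIn-pivot (suc c)       zero    τ       = refl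
punchIn-punchIn-pivot {suc m} (suc c) (suc t) zero    = refl
punchIn-punchIn-pivot {suc m} (suc c) (suc t) (suc τ) = cong suc (punchIn-punchIn-pivot c t τ)

sgn-pivot : ∀ {m} (c : Fin (suc (suc m))) t →
  sgn (toℕ (punchIn c t)) * sgn (toℕ (pivot c t)) ≡ - (sgn (toℕ c) * sgn (toℕ t))
sgn-pivot zero          t       = negate-one (sgn (toℕ t))
  where negate-one : ∀ s → - s * + 1 ≡ - (+ 1 * s)
        negate-one = solve-∀
sgn-pivot (suc c)       zero    = negate-one (sgn (toℕ c))
  where negate-one : ∀ s → + 1 * s ≡ - (- s * + 1)
        negate-one = solve-∀
sgn-pivot {suc m} (suc c) (suc t) =
  trans (neg-*-neg (sgn (toℕ (punchIn c t))) (sgn (toℕ (pivot c t))))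
    (trans (sgn-pivot c t) (cong -_ (sym (neg-*-neg (sgn (toℕ c)) (sgn (toℕ t))))))

-- Expand along row zero, expand each minor along the column that was column c (induction),
-- swap the two sums and recognise the inner sums as row expansions of the minors at (suc r, c).
det-expandColumn : ∀ m (A : Matrix (suc m)) c →
  det (suc m) A ≡ ∑[ i < suc m ] (sgn (toℕ i ℕ.+ toℕ c) * A i c * det m (minor A i c))
det-expandColumn zero    A zero = refl
det-expandColumn (suc m) A c    = begin
  det (suc (suc m)) A                                        ≡⟨ det-expandRow₀ (suc m) A ⟩
  ∑[ j < suc (suc m) ] rowTerm j                             ≡⟨ sum-remove {i = c} rowTerm ⟩
  rowTerm c + ∑[ t < suc m ] rowTerm (punchIn c t)           ≡⟨ cong (_+_ (rowTerm c)) (sum-cong-≗ expandMinor) ⟩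
  rowTerm c + ∑[ t < suc m ] ∑[ r < suc m ] term t r         ≡⟨ cong (_+_ (rowTerm c)) (∑-comm term) ⟩
  rowTerm c + ∑[ r < suc m ] ∑[ t < suc m ] term t r         ≡⟨ cong (_+_ (rowTerm c)) (sum-cong-≗ collect) ⟩
  ∑[ i < suc (suc m) ] colTerm i                             ∎
  where
  rowTerm : Fin (suc (suc m)) → ℤ
  rowTerm j = sgn (toℕ j) * A zero j * det (suc m) (minor A zero j)
  colTerm : Fin (suc (suc m)) → ℤ
  colTerm i = sgn (toℕ i ℕ.+ toℕ c) * A i c * det (suc m) (minor A i c)
  X : Fin (suc m) → Fin (suc m) → Matrix m
  X r t ρ τ = A (suc (punchIn r ρ)) (punchIn c (punchIn t τ))
  term : Fin (suc m) → Fin (suc m) → ℤ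
  term t r = sgn (toℕ (punchIn c t)) * A zero (punchIn c t) *
             (sgn (toℕ r ℕ.+ toℕ (pivot c t)) * A (suc r) c * det m (X r t))

  expandMinor : ∀ t → rowTerm (punchIn c t) ≡ ∑[ r < suc m ] term t r
  expandMinor t = trans (cong (sgn (toℕ (punchIn c t)) * A zero (punchIn c t) *_)
                              (trans (det-expandColumn m (minor A zero (punchIn c t)) (pivot c t))
                                     (sum-cong-≗ entries)))
                        (*-distribˡ-sum (sgn (toℕ (punchIn c t)) * A zero (punchIn c t))
                                        (λ r → sgn (toℕ r ℕ.+ toℕ (pivot c t)) * A (suc r) c * det m (X r t)))
    where
    entries : ∀ r → sgn (toℕ r ℕ.+ toℕ (pivot c t)) * A (suc r) (punchIn (punchIn c t) (pivot c t)) *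
                      det m (minor (minor A zero (punchIn c t)) r (pivot c t))
                  ≡ sgn (toℕ r ℕ.+ toℕ (pivot c t)) * A (suc r) c * det m (X r t)
    entries r = cong₂ (λ a d → sgn (toℕ r ℕ.+ toℕ (pivot c t)) * A (suc r) a * d) (punchIn-pivot c t)
                      (det-cong m (λ ρ τ → cong (A (suc (punchIn r ρ))) (punchIn-punchIn-pivot c t τ)))

  reorder : ∀ P Q C T R a b D → P * Q ≡ - (C * T) →
            P * a * (R * Q * b * D) ≡ - R * C * b * (T * a * D)
  reorder P Q C T R a b D PQ≡-CT = trans (regroup P Q R a b D)
      (trans (cong (_* (R * a * b * D)) PQ≡-CT) (regroup′ C T R a b D))
    where regroup : ∀ P Q R a b D → P * a * (R * Q * b * D) ≡ P * Q * (R * a * b * D)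
          regroup = solve-∀
          regroup′ : ∀ C T R a b D → - (C * T) * (R * a * b * D) ≡ - R * C * b * (T * a * D)
          regroup′ = solve-∀

  moveSigns : ∀ r t → term t r ≡
    sgn (suc (toℕ r) ℕ.+ toℕ c) * A (suc r) c * (sgn (toℕ t) * A zero (punchIn c t) * det m (X r t))
  moveSigns r t = begin
    term t r
      ≡⟨ cong (λ s → sgn (toℕ (punchIn c t)) * A zero (punchIn c t) * (s * A (suc r) c * det m (X r t)))
              (sgn-+ (toℕ r) (toℕ (pivot c t))) ⟩
    sgn (toℕ (punchIn c t)) * A zero (punchIn c t) *
      (sgn (toℕ r) * sgn (toℕ (pivot c t)) * A (suc r) c * det m (X r t))
      ≡⟨ reorder (sgn (toℕ (punchIn c t))) (sgn (toℕ (pivot c t))) (sgn (toℕ c)) (sgn (toℕ t)) (sgn (toℕ r))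
                 (A zero (punchIn c t)) (A (suc r) c) (det m (X r t)) (sgn-pivot c t) ⟩
    - sgn (toℕ r) * sgn (toℕ c) * A (suc r) c * (sgn (toℕ t) * A zero (punchIn c t) * det m (X r t))
      ≡⟨ cong (λ s → s * A (suc r) c * (sgn (toℕ t) * A zero (punchIn c t) * det m (X r t)))
              (sgn-+ (suc (toℕ r)) (toℕ c)) ⟨
    sgn (suc (toℕ r) ℕ.+ toℕ c) * A (suc r) c * (sgn (toℕ t) * A zero (punchIn c t) * det m (X r t)) ∎

  collect : ∀ r → ∑[ t < suc m ] term t r ≡ colTerm (suc r)
  collect r = begin
    ∑[ t < suc m ] term t r
      ≡⟨ sum-cong-≗ (moveSigns r) ⟩
    ∑[ t < suc m ] (sgn (suc (toℕ r) ℕ.+ toℕ c) * A (suc r) c * (sgn (toℕ t) * A zero (punchIn c t) * det m (X r t)))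
      ≡⟨ *-distribˡ-sum (sgn (suc (toℕ r) ℕ.+ toℕ c) * A (suc r) c)
                        (λ t → sgn (toℕ t) * A zero (punchIn c t) * det m (X r t)) ⟨
    sgn (suc (toℕ r) ℕ.+ toℕ c) * A (suc r) c * ∑[ t < suc m ] (sgn (toℕ t) * A zero (punchIn c t) * det m (X r t))
      ≡⟨ cong (sgn (suc (toℕ r) ℕ.+ toℕ c) * A (suc r) c *_) (det-expandRow₀ m (minor A (suc r) c)) ⟨
    colTerm (suc r) ∎

det-transpose : ∀ m (A : Matrix m) → det m (A ᵀ) ≡ det m A
det-transpose zero    A = refl
det-transpose (suc m) A = begin
  det (suc m) (A ᵀ)                                                          ≡⟨ det-expandRow₀ m (A ᵀ) ⟩
  ∑[ j < suc m ] (sgn (toℕ j) * A j zero * det m (minor (A ᵀ) zero j))        ≡⟨ sum-cong-≗ term ⟩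
  ∑[ i < suc m ] (sgn (toℕ i ℕ.+ 0) * A i zero * det m (minor A i zero))      ≡⟨ det-expandColumn m A zero ⟨
  det (suc m) A                                                              ∎
  where
  term : ∀ j → sgn (toℕ j) * A j zero * det m (minor (A ᵀ) zero j)
             ≡ sgn (toℕ j ℕ.+ 0) * A j zero * det m (minor A j zero)
  term j = cong₂ (λ s d → s * A j zero * d) (cong sgn (sym (ℕ.+-identityʳ (toℕ j))))
                 (det-transpose m (minor A j zero))

-- Lehmer codes: a permutation of Fin (suc k) is given by its value at zero and a code for the rest
data Lehmer : ℕ → Set where
  []  : Lehmer zero
  _∷_ : ∀ {k} → Fin (suc k) → Lehmer k → Lehmer (suc k)

⟦_⟧ : ∀ {k} → Lehmer k → Fin k → Fin k
⟦ a ∷ π ⟧ zero    = a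
⟦ a ∷ π ⟧ (suc t) = punchIn a (⟦ π ⟧ t)

sign : ∀ {k} → Lehmer k → ℤ
sign []      = + 1
sign (a ∷ π) = sgn (toℕ a) * sign π

sign-*-sign : ∀ {k} (π : Lehmer k) → sign π * sign π ≡ + 1
sign-*-sign []      = refl
sign-*-sign (a ∷ π) = begin
  sgn (toℕ a) * sign π * (sgn (toℕ a) * sign π)    ≡⟨ interchange (sgn (toℕ a)) (sign π) ⟩
  sgn (toℕ a) * sgn (toℕ a) * (sign π * sign π)    ≡⟨ cong₂ _*_ (sgn-*-sgn (toℕ a)) (sign-*-sign π) ⟩
  + 1                                              ∎
  where interchange : ∀ x y → x * y * (x * y) ≡ x * x * (y * y)
        interchange = solve-∀

det-permuteColumns : ∀ k (π : Lehmer k) (A : Matrix k) → det k (λ i j → A i (⟦ π ⟧ j)) ≡ sign π * det k A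
det-permuteColumns zero    []      A = refl
det-permuteColumns (suc k) (a ∷ π) A = begin
  det (suc k) (λ i j → A i (⟦ a ∷ π ⟧ j))
    ≡⟨ det-expandColumn k (λ i j → A i (⟦ a ∷ π ⟧ j)) zero ⟩
  ∑[ i < suc k ] (sgn (toℕ i ℕ.+ 0) * A i a * det k (λ r t → minor A i a r (⟦ π ⟧ t)))
    ≡⟨ sum-cong-≗ term ⟩
  ∑[ i < suc k ] (sgn (toℕ a) * sign π * (sgn (toℕ i ℕ.+ toℕ a) * A i a * det k (minor A i a)))
    ≡⟨ *-distribˡ-sum (sgn (toℕ a) * sign π) (λ i → sgn (toℕ i ℕ.+ toℕ a) * A i a * det k (minor A i a)) ⟨
  sgn (toℕ a) * sign π * ∑[ i < suc k ] (sgn (toℕ i ℕ.+ toℕ a) * A i a * det k (minor A i a))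
    ≡⟨ cong (sgn (toℕ a) * sign π *_) (det-expandColumn k A a) ⟨
  sign (a ∷ π) * det (suc k) A ∎
  where
  -- the factor sgn a is inserted as sgn a * sgn a = 1
  rearrange : ∀ I S P x D → S * S ≡ + 1 → I * + 1 * x * (P * D) ≡ S * P * (I * S * x * D)
  rearrange I S P x D S*S≡1 = trans (regroup I S P x D) (trans (cong (_* (I * P * x * D)) (sym S*S≡1)) (regroup′ I S P x D))
    where regroup : ∀ I S P x D → I * + 1 * x * (P * D) ≡ + 1 * (I * P * x * D)
          regroup = solve-∀
          regroup′ : ∀ I S P x D → S * S * (I * P * x * D) ≡ S * P * (I * S * x * D)
          regroup′ = solve-∀
  term : ∀ i → sgn (toℕ i ℕ.+ 0) * A i a * det k (λ r t → minor A i a r (⟦ π ⟧ t))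
             ≡ sgn (toℕ a) * sign π * (sgn (toℕ i ℕ.+ toℕ a) * A i a * det k (minor A i a))
  term i
    rewrite sgn-+ (toℕ i) 0 | sgn-+ (toℕ i) (toℕ a) | det-permuteColumns k π (minor A i a) =
    rearrange (sgn (toℕ i)) (sgn (toℕ a)) (sign π) (A i a) (det k (minor A i a)) (sgn-*-sgn (toℕ a))

det-permuteRows : ∀ k (π : Lehmer k) (A : Matrix k) → det k (λ i j → A (⟦ π ⟧ i) j) ≡ sign π * det k A
det-permuteRows k π A = begin
  det k (λ i j → A (⟦ π ⟧ i) j)      ≡⟨ det-transpose k (λ i j → A (⟦ π ⟧ i) j) ⟨
  det k (λ i j → (A ᵀ) i (⟦ π ⟧ j))  ≡⟨ det-permuteColumns k π (A ᵀ) ⟩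
  sign π * det k (A ᵀ)               ≡⟨ cong (sign π *_) (det-transpose k A) ⟩
  sign π * det k A                   ∎

det-permute : ∀ k (π : Lehmer k) (A : Matrix k) → det k (λ i j → A (⟦ π ⟧ i) (⟦ π ⟧ j)) ≡ det k A
det-permute k π A = begin
  det k (λ i j → A (⟦ π ⟧ i) (⟦ π ⟧ j))  ≡⟨ det-permuteColumns k π (λ i j → A (⟦ π ⟧ i) j) ⟩
  sign π * det k (λ i j → A (⟦ π ⟧ i) j) ≡⟨ cong (sign π *_) (det-permuteRows k π A) ⟩
  sign π * (sign π * det k A)            ≡⟨ ℤ.*-assoc (sign π) (sign π) (det k A) ⟨
  sign π * sign π * det k A              ≡⟨ cong (_* det k A) (sign-*-sign π) ⟩
  + 1 * det k A                          ≡⟨ ℤ.*-identityˡ (det k A) ⟩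
  det k A                                ∎

lehmer : ∀ k (f : Fin k → Fin k) → Injective _≡_ _≡_ f → Lehmer k
lehmer zero    f f-inj = []
lehmer (suc k) f f-inj = f zero ∷ lehmer k f′ f′-inj
  where
  f0≢f : ∀ t → f zero ≢ f (suc t)
  f0≢f t eq with () ← f-inj eq
  f′ : Fin k → Fin k
  f′ t = punchOut (f0≢f t)
  f′-inj : Injective _≡_ _≡_ f′
  f′-inj eq = Fin.suc-injective (f-inj (Fin.punchOut-injective (f0≢f _) (f0≢f _) eq))

⟦lehmer⟧ : ∀ k (f : Fin k → Fin k) (f-inj : Injective _≡_ _≡_ f) → ∀ i → ⟦ lehmer k f f-inj ⟧ i ≡ f i
⟦lehmer⟧ (suc k) f f-inj zero    = refl
⟦lehmer⟧ (suc k) f f-inj (suc t) =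
  trans (cong (punchIn (f zero)) (⟦lehmer⟧ k _ _ t)) (Fin.punchIn-punchOut _)

det-reindex : ∀ k (f : Fin k → Fin k) → Injective _≡_ _≡_ f → (A : Matrix k) →
  det k (λ i j → A (f i) (f j)) ≡ det k A
det-reindex k f f-inj A = begin
  det k (λ i j → A (f i) (f j))          ≡⟨ det-cong k (λ i j → sym (cong₂ A (⟦lehmer⟧ k f f-inj i) (⟦lehmer⟧ k f f-inj j))) ⟩
  det k (λ i j → A (⟦ π ⟧ i) (⟦ π ⟧ j))  ≡⟨ det-permute k π A ⟩
  det k A                                ∎
  where
  π : Lehmer k
  π = lehmer k f f-inj

det-equalColumns₀₁ : ∀ m (A : Matrix (suc (suc m))) → (∀ i → A i zero ≡ A i (suc zero)) →
  det (suc (suc m)) A ≡ + 0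
det-equalColumns₀₁ m A col₀≡col₁ = begin
  det (suc (suc m)) A
    ≡⟨ det-expandRow₀ (suc m) A ⟩
  rowTerm zero + (rowTerm (suc zero) + ∑[ t < m ] rowTerm (suc (suc t)))
    ≡⟨ cong₂ (λ x y → rowTerm zero + (x + y)) firstTwoCancel (sum-zero _ (laterVanish m A col₀≡col₁)) ⟩
  rowTerm zero + (- rowTerm zero + + 0)
    ≡⟨ cancel (rowTerm zero) ⟩
  + 0 ∎
  where
  rowTerm : Fin (suc (suc m)) → ℤ
  rowTerm j = sgn (toℕ j) * A zero j * det (suc m) (minor A zero j)
  negate : ∀ a d → - + 1 * a * d ≡ - (+ 1 * a * d)
  negate = solve-∀
  firstTwoCancel : rowTerm (suc zero) ≡ - rowTerm zero
  firstTwoCancel = begin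
    - + 1 * A zero (suc zero) * det (suc m) (minor A zero (suc zero))
      ≡⟨ cong₂ (λ a d → - + 1 * a * d) (sym (col₀≡col₁ zero))
               (det-cong (suc m) {minor A zero (suc zero)} {minor A zero zero} λ { i zero → col₀≡col₁ (suc i) ; i (suc k) → refl }) ⟩
    - + 1 * A zero zero * det (suc m) (minor A zero zero)
      ≡⟨ negate (A zero zero) (det (suc m) (minor A zero zero)) ⟩
    - rowTerm zero ∎
  cancel : ∀ x → x + (- x + + 0) ≡ + 0
  cancel = solve-∀
  laterVanish : ∀ m (A : Matrix (suc (suc m))) → (∀ i → A i zero ≡ A i (suc zero)) →
    (t : Fin m) → sgn (toℕ (suc (suc t))) * A zero (suc (suc t)) * det (suc m) (minor A zero (suc (suc t))) ≡ + 0
  laterVanish (suc m) A col₀≡col₁ t =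
    trans (cong (sgn (toℕ (suc (suc t))) * A zero (suc (suc t)) *_)
                (det-equalColumns₀₁ m (minor A zero (suc (suc t))) (col₀≡col₁ ∘ suc)))
          (ℤ.*-zeroʳ (sgn (toℕ (suc (suc t))) * A zero (suc (suc t))))

det-equalColumns : ∀ m (A : Matrix m) {c c′} → c ≢ c′ → (∀ i → A i c ≡ A i c′) → det m A ≡ + 0
det-equalColumns (suc zero)    A {zero} {zero} c≢c′ _ = ⊥-elim (c≢c′ refl)
det-equalColumns (suc (suc m)) A {c}    {c′}   c≢c′ colc≡colc′ = begin
  det (suc (suc m)) A                                      ≡⟨ ℤ.*-identityˡ _ ⟨
  + 1 * det (suc (suc m)) A                                ≡⟨ cong (_* det (suc (suc m)) A) (sign-*-sign π) ⟨
  sign π * sign π * det (suc (suc m)) A                    ≡⟨ ℤ.*-assoc (sign π) (sign π) _ ⟩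
  sign π * (sign π * det (suc (suc m)) A)                  ≡⟨ cong (sign π *_) (det-permuteColumns _ π A) ⟨
  sign π * det (suc (suc m)) (λ i j → A i (⟦ π ⟧ j))      ≡⟨ cong (sign π *_)
                                                                   (det-equalColumns₀₁ m (λ i j → A i (⟦ π ⟧ j)) permutedEqual) ⟩
  sign π * + 0                                             ≡⟨ ℤ.*-zeroʳ (sign π) ⟩
  + 0                                                      ∎
  where
  π : Lehmer (suc (suc m))
  π = c ∷ (punchOut c≢c′ ∷ lehmer m (λ i → i) (λ eq → eq))
  permutedEqual : ∀ i → A i c ≡ A i (punchIn c (punchOut c≢c′))
  permutedEqual i = trans (colc≡colc′ i) (cong (A i) (sym (Fin.punchIn-punchOut c≢c′)))

isYes-true : ∀ {a} {P : Set a} (p? : Dec P) → P → ⌊ p? ⌋ ≡ true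
isYes-true p? p = trans (isYes≗does p?) (dec-true p? p)

isYes-false : ∀ {a} {P : Set a} (p? : Dec P) → ¬ P → ⌊ p? ⌋ ≡ false
isYes-false p? ¬p = trans (isYes≗does p?) (dec-false p? ¬p)

δ : ∀ {m} → Fin m → Fin m → ℤ
δ i j = if ⌊ i ≟ j ⌋ then + 1 else + 0

δ-refl : ∀ {m} (i : Fin m) → δ i i ≡ + 1
δ-refl i = cong (if_then + 1 else + 0) (isYes-true (i ≟ i) refl)

δ-≢ : ∀ {m} {i j : Fin m} → i ≢ j → δ i j ≡ + 0
δ-≢ {i = i} {j} i≢j = cong (if_then + 1 else + 0) (isYes-false (i ≟ j) i≢j)

setColumn : ∀ {m} → Matrix m → Fin m → (Fin m → ℤ) → Matrix m
setColumn A c v i j = if ⌊ j ≟ c ⌋ then v i else A i j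

setColumn-≡ : ∀ {m} (A : Matrix m) c v i → setColumn A c v i c ≡ v i
setColumn-≡ A c v i = cong (if_then v i else A i c) (isYes-true (c ≟ c) refl)

setColumn-≢ : ∀ {m} (A : Matrix m) c v i {j} → j ≢ c → setColumn A c v i j ≡ A i j
setColumn-≢ A c v i {j} j≢c = cong (if_then v i else A i j) (isYes-false (j ≟ c) j≢c)

setColumn-self : ∀ {m} (A : Matrix m) c i j → setColumn A c (λ r → A r c) i j ≡ A i j
setColumn-self A c i j with j ≟ c
... | yes refl = refl
... | no  _    = refl

det-setColumn : ∀ m (A : Matrix (suc m)) c v →
  det (suc m) (setColumn A c v) ≡ ∑[ i < suc m ] (sgn (toℕ i ℕ.+ toℕ c) * v i * det m (minor A i c))
det-setColumn m A c v = trans (det-expandColumn m (setColumn A c v) c) (sum-cong-≗ term)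
  where
  term : ∀ i → sgn (toℕ i ℕ.+ toℕ c) * setColumn A c v i c * det m (minor (setColumn A c v) i c)
             ≡ sgn (toℕ i ℕ.+ toℕ c) * v i * det m (minor A i c)
  term i = cong₂ (λ a d → sgn (toℕ i ℕ.+ toℕ c) * a * d) (setColumn-≡ A c v i)
                 (det-cong m (λ r t → setColumn-≢ A c v (punchIn i r) (Fin.punchInᵢ≢i c t)))

det-setColumn-+ : ∀ m (A : Matrix (suc m)) c v w →
  det (suc m) (setColumn A c (λ i → v i + w i)) ≡ det (suc m) (setColumn A c v) + det (suc m) (setColumn A c w)
det-setColumn-+ m A c v w = begin
  det (suc m) (setColumn A c (λ i → v i + w i))
    ≡⟨ det-setColumn m A c (λ i → v i + w i) ⟩
  ∑[ i < suc m ] (sgn (toℕ i ℕ.+ toℕ c) * (v i + w i) * det m (minor A i c))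
    ≡⟨ sum-cong-≗ (λ i → distrib (sgn (toℕ i ℕ.+ toℕ c)) (v i) (w i) (det m (minor A i c))) ⟩
  ∑[ i < suc m ] (term v i + term w i)
    ≡⟨ ∑-distrib-+ (term v) (term w) ⟩
  ∑[ i < suc m ] term v i + ∑[ i < suc m ] term w i
    ≡⟨ cong₂ _+_ (det-setColumn m A c v) (det-setColumn m A c w) ⟨
  det (suc m) (setColumn A c v) + det (suc m) (setColumn A c w) ∎
  where
  term : (Fin (suc m) → ℤ) → Fin (suc m) → ℤ
  term u i = sgn (toℕ i ℕ.+ toℕ c) * u i * det m (minor A i c)
  distrib : ∀ s a b d → s * (a + b) * d ≡ s * a * d + s * b * d
  distrib = solve-∀

det-setColumn-* : ∀ m (A : Matrix (suc m)) c x v →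
  det (suc m) (setColumn A c (λ i → x * v i)) ≡ x * det (suc m) (setColumn A c v)
det-setColumn-* m A c x v = begin
  det (suc m) (setColumn A c (λ i → x * v i))
    ≡⟨ det-setColumn m A c (λ i → x * v i) ⟩
  ∑[ i < suc m ] (sgn (toℕ i ℕ.+ toℕ c) * (x * v i) * det m (minor A i c))
    ≡⟨ sum-cong-≗ (λ i → pull (sgn (toℕ i ℕ.+ toℕ c)) x (v i) (det m (minor A i c))) ⟩
  ∑[ i < suc m ] (x * (sgn (toℕ i ℕ.+ toℕ c) * v i * det m (minor A i c)))
    ≡⟨ *-distribˡ-sum x (λ i → sgn (toℕ i ℕ.+ toℕ c) * v i * det m (minor A i c)) ⟨
  x * ∑[ i < suc m ] (sgn (toℕ i ℕ.+ toℕ c) * v i * det m (minor A i c))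
    ≡⟨ cong (x *_) (det-setColumn m A c v) ⟨
  x * det (suc m) (setColumn A c v) ∎
  where
  pull : ∀ s x a d → s * (x * a) * d ≡ x * (s * a * d)
  pull = solve-∀

det-copyColumn : ∀ m (A : Matrix (suc m)) {c c′} → c′ ≢ c → det (suc m) (setColumn A c (λ i → A i c′)) ≡ + 0
det-copyColumn m A {c} {c′} c′≢c = det-equalColumns (suc m) (setColumn A c (λ i → A i c′)) (c′≢c ∘ sym)
  (λ i → trans (setColumn-≡ A c (λ r → A r c′) i) (sym (setColumn-≢ A c (λ r → A r c′) i c′≢c)))

det-addColumn : ∀ m (A : Matrix (suc m)) {c c′} → c′ ≢ c →
  det (suc m) (setColumn A c (λ i → A i c + A i c′)) ≡ det (suc m) A
det-addColumn m A {c} {c′} c′≢c = begin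
  det (suc m) (setColumn A c (λ i → A i c + A i c′))
    ≡⟨ det-setColumn-+ m A c (λ i → A i c) (λ i → A i c′) ⟩
  det (suc m) (setColumn A c (λ i → A i c)) + det (suc m) (setColumn A c (λ i → A i c′))
    ≡⟨ cong₂ _+_ (det-cong (suc m) (setColumn-self A c)) (det-copyColumn m A c′≢c) ⟩
  det (suc m) A + + 0
    ≡⟨ ℤ.+-identityʳ _ ⟩
  det (suc m) A ∎

det-setColumn-cong : ∀ m (A : Matrix m) c {v w : Fin m → ℤ} → (∀ i → v i ≡ w i) →
  det m (setColumn A c v) ≡ det m (setColumn A c w)
det-setColumn-cong m A c v≗w = det-cong m (λ i j → cong (λ x → if ⌊ j ≟ c ⌋ then x else A i j) (v≗w i))

det-subColumn : ∀ m (A : Matrix (suc m)) {c c′} → c′ ≢ c →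
  det (suc m) (setColumn A c (λ i → A i c - A i c′)) ≡ det (suc m) A
det-subColumn m A {c} {c′} c′≢c = begin
  det (suc m) (setColumn A c (λ i → A i c - A i c′))
    ≡⟨ det-setColumn-cong (suc m) A c (λ i → cong (_+_ (A i c)) (sym (ℤ.-1*i≡-i (A i c′)))) ⟩
  det (suc m) (setColumn A c (λ i → A i c + - + 1 * A i c′))
    ≡⟨ det-setColumn-+ m A c (λ i → A i c) (λ i → - + 1 * A i c′) ⟩
  det (suc m) (setColumn A c (λ i → A i c)) + det (suc m) (setColumn A c (λ i → - + 1 * A i c′))
    ≡⟨ cong₂ _+_ (det-cong (suc m) (setColumn-self A c)) (det-setColumn-* m A c (- + 1) (λ i → A i c′)) ⟩
  det (suc m) A + - + 1 * det (suc m) (setColumn A c (λ i → A i c′))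
    ≡⟨ cong (λ d → det (suc m) A + - + 1 * d) (det-copyColumn m A c′≢c) ⟩
  det (suc m) A + - + 1 * + 0
    ≡⟨ ℤ.+-identityʳ _ ⟩
  det (suc m) A ∎

addRow : ∀ {m} → Matrix m → Fin m → Fin m → Matrix m
addRow A r r′ = setColumn (A ᵀ) r (λ j → A r j + A r′ j) ᵀ

addRow-≡ : ∀ {m} (A : Matrix m) r r′ j → addRow A r r′ r j ≡ A r j + A r′ j
addRow-≡ A r r′ j = setColumn-≡ (A ᵀ) r (λ j → A r j + A r′ j) j

addRow-≢ : ∀ {m} (A : Matrix m) r r′ {i} j → i ≢ r → addRow A r r′ i j ≡ A i j
addRow-≢ A r r′ j i≢r = setColumn-≢ (A ᵀ) r (λ j → A r j + A r′ j) j i≢r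

det-addRow : ∀ m (A : Matrix (suc m)) {r r′} → r′ ≢ r → det (suc m) (addRow A r r′) ≡ det (suc m) A
det-addRow m A {r} {r′} r′≢r = begin
  det (suc m) (addRow A r r′)                                ≡⟨ det-transpose (suc m) (setColumn (A ᵀ) r (λ j → A r j + A r′ j)) ⟩
  det (suc m) (setColumn (A ᵀ) r (λ j → A r j + A r′ j))     ≡⟨ det-addColumn m (A ᵀ) r′≢r ⟩
  det (suc m) (A ᵀ)                                          ≡⟨ det-transpose (suc m) A ⟩
  det (suc m) A                                              ∎

det-unitColumn : ∀ m (A : Matrix (suc m)) c → (∀ i → A i c ≡ δ i c) → det (suc m) A ≡ det m (minor A c c)
det-unitColumn m A c colc≡e = begin
  det (suc m) A
    ≡⟨ det-expandColumn m A c ⟩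
  ∑[ i < suc m ] term i
    ≡⟨ sum-single term c (λ i i≢c → trans (cong (λ a → sgn (toℕ i ℕ.+ toℕ c) * a * det m (minor A i c))
                                                 (trans (colc≡e i) (δ-≢ i≢c)))
                                           (kill (sgn (toℕ i ℕ.+ toℕ c)) (det m (minor A i c)))) ⟩
  term c
    ≡⟨ cong₂ (λ s a → s * a * det m (minor A c c)) (trans (sgn-+ (toℕ c) (toℕ c)) (sgn-*-sgn (toℕ c)))
             (trans (colc≡e c) (δ-refl c)) ⟩
  + 1 * + 1 * det m (minor A c c)
    ≡⟨ ℤ.*-identityˡ _ ⟩
  det m (minor A c c) ∎
  where
  term : Fin (suc m) → ℤ
  term i = sgn (toℕ i ℕ.+ toℕ c) * A i c * det m (minor A i c)
  kill : ∀ s d → s * + 0 * d ≡ + 0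
  kill = solve-∀

-- Lumping a matrix along a map onto classes

δℕ : ∀ {m} → Fin m → Fin m → ℕ
δℕ i j = if ⌊ i ≟ j ⌋ then 1 else 0

δℕ-refl : ∀ {m} (i : Fin m) → δℕ i i ≡ 1
δℕ-refl i = cong (if_then 1 else 0) (isYes-true (i ≟ i) refl)

δℕ-≢ : ∀ {m} {i j : Fin m} → i ≢ j → δℕ i j ≡ 0
δℕ-≢ {i = i} {j} i≢j = cong (if_then 1 else 0) (isYes-false (i ≟ j) i≢j)

sum-δℕ : ∀ {m} (r : Fin m) → ℕΣ.sum (λ π → δℕ π r) ≡ 1
sum-δℕ r = trans (ℕΣ.sum-single (λ π → δℕ π r) r (λ π π≢r → δℕ-≢ π≢r)) (δℕ-refl r)

δ-injective : ∀ {m n} (f : Fin m → Fin n) → Injective _≡_ _≡_ f → ∀ i j → δ (f i) (f j) ≡ δ i j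
δ-injective f f-inj i j with i ≟ j
... | yes refl = δ-refl (f i)
... | no  i≢j  = δ-≢ (i≢j ∘ f-inj)

sumℕ-const : ∀ {m} (f : Fin m → ℕ) c → (∀ i → f i ≡ c) → ℕΣ.sum f ≡ m ℕ.* c
sumℕ-const {zero}  f c f≡c = refl
sumℕ-const {suc m} f c f≡c = cong₂ ℕ._+_ (f≡c zero) (sumℕ-const (f ∘ suc) c (f≡c ∘ suc))

sumℕ-positive : ∀ {m} (f : Fin m → ℕ) i → f i ≡ 1 → ∃ λ s → ℕΣ.sum f ≡ suc s
sumℕ-positive {suc m} f i fi≡1 = _ , trans (ℕΣ.sum-remove {i = i} f) (cong (ℕ._+ ℕΣ.sum (f ∘ punchIn i)) fi≡1)

section-injective : ∀ {m k} (κ : Fin m → Fin k) (κ-onto : StrictlySurjective _≡_ κ) →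
  Injective _≡_ _≡_ (proj₁ ∘ κ-onto)
section-injective κ κ-onto {c} {c′} eq = trans (sym (proj₂ (κ-onto c))) (trans (cong κ eq) (proj₂ (κ-onto c′)))

fiberSize : ∀ {m k} → (Fin m → Fin k) → Fin k → ℕ
fiberSize κ c = ℕΣ.sum (λ u → δℕ (κ u) c)

fiberSum : ∀ {m k} → (Fin m → Fin k) → (Fin m → ℤ) → Fin k → ℤ
fiberSum κ ω c = sum (λ u → δ (κ u) c * ω u)

δ-*-one : ∀ {m} (i j : Fin m) → δ i j * + 1 ≡ + δℕ i j
δ-*-one i j with i ≟ j
... | yes _ = refl
... | no  _ = refl

fiberSum-ones : ∀ {m k} (κ : Fin m → Fin k) c → fiberSum κ (λ _ → + 1) c ≡ + fiberSize κ c
fiberSum-ones {zero}  κ c = refl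
fiberSum-ones {suc m} κ c = trans (cong₂ _+_ (δ-*-one (κ zero) c) (fiberSum-ones (κ ∘ suc) c))
                                  (sym (ℤ.pos-+ (δℕ (κ zero) c) (fiberSize (κ ∘ suc) c)))

product-^ : ∀ {m} y (e : Fin m → ℕ) → product (λ i → y ^ e i) ≡ y ^ ℕΣ.sum e
product-^ {zero}  y e = refl
product-^ {suc m} y e = trans (cong (y ^ e zero *_) (product-^ y (e ∘ suc)))
                              (sym (ℤ.^-distribˡ-+-* y (e zero) (ℕΣ.sum (e ∘ suc))))

fiber-inhabited : ∀ {m k} (κ : Fin m → Fin k) c {s} → fiberSize κ c ≡ suc s → ∃ λ u → κ u ≡ c
fiber-inhabited {suc m} κ c size≡ with κ zero ≟ c
... | yes κ0≡c = zero , κ0≡c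
... | no  _    with u , κu≡c ← fiber-inhabited (κ ∘ suc) c size≡ = suc u , κu≡c

surjective-fiberSize : ∀ {m k} (κ : Fin m → Fin k) → (∀ c → ∃ λ s → fiberSize κ c ≡ suc s) → StrictlySurjective _≡_ κ
surjective-fiberSize κ positive c = fiber-inhabited κ c (proj₂ (positive c))

sum-const-pos : ∀ {m} (f : Fin m → ℤ) a → (∀ i → f i ≡ + a) → sum f ≡ + (m ℕ.* a)
sum-const-pos {zero}  f a f≡a = refl
sum-const-pos {suc m} f a f≡a = trans (cong₂ _+_ (f≡a zero) (sum-const-pos (f ∘ suc) a (f≡a ∘ suc)))
                                      (sym (ℤ.pos-+ a (m ℕ.* a)))

module Lumping {k} (lam : Fin k → ℤ) (B : Matrix k) where

  lift : ∀ {m} → (Fin m → Fin k) → (Fin m → ℤ) → Matrix m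
  lift κ ω u v = δ u v * lam (κ u) + ω u * B (κ u) (κ v)

  quotient : (Fin k → ℤ) → Matrix k
  quotient W = lift (λ c → c) W

  fiberFactor : ∀ {m} → (Fin m → Fin k) → ℤ
  fiberFactor κ = product (λ c → lam c ^ (fiberSize κ c ∸ 1))

  det-lift-bijective : ∀ m (κ : Fin m → Fin k) ω → Injective _≡_ _≡_ κ → StrictlySurjective _≡_ κ →
    det m (lift κ ω) ≡ fiberFactor κ * det k (quotient (fiberSum κ ω))
  det-lift-bijective m κ ω κ-inj κ-onto with refl ← Fin.cantor-schröder-bernstein κ-inj (section-injective κ κ-onto) = begin
    det k (lift κ ω)                                            ≡⟨ det-cong k entries ⟩
    det k (λ u v → quotient (fiberSum κ ω) (κ u) (κ v))         ≡⟨ det-reindex k κ κ-inj (quotient (fiberSum κ ω)) ⟩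
    det k (quotient (fiberSum κ ω))                             ≡⟨ ℤ.*-identityˡ _ ⟨
    + 1 * det k (quotient (fiberSum κ ω))                       ≡⟨ cong (_* det k (quotient (fiberSum κ ω))) factor≡1 ⟨
    fiberFactor κ * det k (quotient (fiberSum κ ω))             ∎
    where
    fiber≡ : ∀ u → fiberSum κ ω (κ u) ≡ ω u
    fiber≡ u = trans (sum-single (λ v → δ (κ v) (κ u) * ω v) u
                       (λ v v≢u → trans (cong (_* ω v) (δ-≢ (v≢u ∘ κ-inj))) (ℤ.*-zeroˡ (ω v))))
                     (trans (cong (_* ω u) (δ-refl (κ u))) (ℤ.*-identityˡ (ω u)))
    entries : ∀ u v → lift κ ω u v ≡ quotient (fiberSum κ ω) (κ u) (κ v)
    entries u v = cong₂ (λ d w → d * lam (κ u) + w * B (κ u) (κ v)) (sym (δ-injective κ κ-inj u v)) (sym (fiber≡ u))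
    size≡1 : ∀ c → fiberSize κ c ≡ 1
    size≡1 c with u , κu≡c ← κ-onto c = trans
      (ℕΣ.sum-single (λ v → δℕ (κ v) c) u (λ v v≢u → δℕ-≢ (λ κv≡c → v≢u (κ-inj (trans κv≡c (sym κu≡c))))))
      (trans (cong (λ d → δℕ d c) κu≡c) (δℕ-refl c))
    factor≡1 : fiberFactor κ ≡ + 1
    factor≡1 = product-one _ (λ c → cong (λ s → lam c ^ (s ∸ 1)) (size≡1 c))

  module Merge {m} (κ : Fin (suc m) → Fin k) (ω : Fin (suc m) → ℤ)
               {u u′ : Fin (suc m)} (u≢u′ : u ≢ u′) (κu≡κu′ : κ u ≡ κ u′) where

    κ′ : Fin m → Fin k
    κ′ = κ ∘ punchIn u

    -- the row operation adds row u to row u′, so u′ inherits the weight of u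
    ω′ : Fin m → ℤ
    ω′ t = ω (punchIn u t) + δ (punchIn u t) u′ * ω u

    private
      A : Matrix (suc m)
      A = lift κ ω
      unitDiff : Fin (suc m) → ℤ
      unitDiff r = δ r u - δ r u′
      A₁ : Matrix (suc m)
      A₁ = setColumn A u unitDiff
      A₂ : Matrix (suc m)
      A₂ = addRow A₁ u′ u
      t′ : Fin m
      t′ = punchOut u≢u′
      punchIn-t′ : punchIn u t′ ≡ u′
      punchIn-t′ = Fin.punchIn-punchOut u≢u′

    unitDiff-scaling : ∀ r → unitDiff r * lam (κ r) ≡ lam (κ u) * unitDiff r
    unitDiff-scaling r = scaling (r ≟ u) (r ≟ u′)
      where
      scaling : Dec (r ≡ u) → Dec (r ≡ u′) → unitDiff r * lam (κ r) ≡ lam (κ u) * unitDiff r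
      scaling (yes r≡u) _          = trans (cong (λ c → unitDiff r * lam (κ c)) r≡u) (ℤ.*-comm (unitDiff r) (lam (κ u)))
      scaling (no _)    (yes r≡u′) = trans (cong (λ c → unitDiff r * lam c) (trans (cong κ r≡u′) (sym κu≡κu′)))
                                           (ℤ.*-comm (unitDiff r) (lam (κ u)))
      scaling (no r≢u)  (no r≢u′)  = begin
        unitDiff r * lam (κ r)  ≡⟨ cong (_* lam (κ r)) unitDiff≡0 ⟩
        + 0 * lam (κ r)         ≡⟨ ℤ.*-zeroˡ (lam (κ r)) ⟩
        + 0                     ≡⟨ ℤ.*-zeroʳ (lam (κ u)) ⟨
        lam (κ u) * + 0         ≡⟨ cong (lam (κ u) *_) unitDiff≡0 ⟨
        lam (κ u) * unitDiff r  ∎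
        where unitDiff≡0 : unitDiff r ≡ + 0
              unitDiff≡0 = cong₂ _-_ (δ-≢ r≢u) (δ-≢ r≢u′)

    column-difference : ∀ r → A r u - A r u′ ≡ lam (κ u) * unitDiff r
    column-difference r = begin
      A r u - A r u′
        ≡⟨ cong (λ c → A r u - (δ r u′ * lam (κ r) + ω r * B (κ r) c)) (sym κu≡κu′) ⟩
      δ r u * lam (κ r) + ω r * B (κ r) (κ u) - (δ r u′ * lam (κ r) + ω r * B (κ r) (κ u))
        ≡⟨ cancel (δ r u) (δ r u′) (lam (κ r)) (ω r * B (κ r) (κ u)) ⟩
      unitDiff r * lam (κ r)
        ≡⟨ unitDiff-scaling r ⟩
      lam (κ u) * unitDiff r ∎
      where cancel : ∀ d d′ L b → d * L + b - (d′ * L + b) ≡ (d - d′) * L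
            cancel = solve-∀

    unit-column : ∀ r → A₂ r u ≡ δ r u
    unit-column r = unit (r ≟ u′)
      where
      unit : Dec (r ≡ u′) → A₂ r u ≡ δ r u
      unit (yes refl) = begin
        A₂ u′ u                   ≡⟨ addRow-≡ A₁ u′ u u ⟩
        A₁ u′ u + A₁ u u          ≡⟨ cong₂ _+_ (setColumn-≡ A u unitDiff u′) (setColumn-≡ A u unitDiff u) ⟩
        unitDiff u′ + unitDiff u  ≡⟨ cong₂ _+_ (cong₂ _-_ (δ-≢ (u≢u′ ∘ sym)) (δ-refl u′))
                                               (cong₂ _-_ (δ-refl u) (δ-≢ u≢u′)) ⟩
        + 0 - + 1 + (+ 1 - + 0)   ≡⟨ δ-≢ (u≢u′ ∘ sym) ⟨
        δ u′ u                    ∎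
      unit (no r≢u′)  = begin
        A₂ r u                    ≡⟨ addRow-≢ A₁ u′ u u r≢u′ ⟩
        A₁ r u                    ≡⟨ setColumn-≡ A u unitDiff r ⟩
        δ r u - δ r u′            ≡⟨ cong (_-_ (δ r u)) (δ-≢ r≢u′) ⟩
        δ r u - + 0               ≡⟨ ℤ.+-identityʳ (δ r u) ⟩
        δ r u                     ∎

    minor-A₂ : ∀ r t → minor A₂ u u r t ≡ lift κ′ ω′ r t
    minor-A₂ r t = row (punchIn u r ≟ u′)
      where
      T : Fin (suc m)
      T = punchIn u t
      T≢u : T ≢ u
      T≢u = Fin.punchInᵢ≢i u t
      R : Fin (suc m)
      R = punchIn u r
      δ-minor : δ R T ≡ δ r t
      δ-minor = δ-injective (punchIn u) (Fin.punchIn-injective u _ _) r t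
      row : Dec (R ≡ u′) → minor A₂ u u r t ≡ lift κ′ ω′ r t
      row (yes R≡u′) = begin
        A₂ R T
          ≡⟨ cong (λ R → A₂ R T) R≡u′ ⟩
        A₂ u′ T
          ≡⟨ addRow-≡ A₁ u′ u T ⟩
        A₁ u′ T + A₁ u T
          ≡⟨ cong₂ _+_ (setColumn-≢ A u unitDiff u′ T≢u) (setColumn-≢ A u unitDiff u T≢u) ⟩
        A u′ T + A u T
          ≡⟨ cong₂ (λ d c → δ u′ T * lam (κ u′) + ω u′ * B (κ u′) (κ T) + (d * lam (κ u) + ω u * B c (κ T)))
                   (δ-≢ (T≢u ∘ sym)) κu≡κu′ ⟩
        δ u′ T * lam (κ u′) + ω u′ * B (κ u′) (κ T) + (+ 0 * lam (κ u) + ω u * B (κ u′) (κ T))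
          ≡⟨ collect (δ u′ T) (lam (κ u′)) (lam (κ u)) (ω u′) (ω u) (B (κ u′) (κ T)) ⟩
        δ u′ T * lam (κ u′) + (ω u′ + + 1 * ω u) * B (κ u′) (κ T)
          ≡⟨ cong (λ d → δ u′ T * lam (κ u′) + (ω u′ + d * ω u) * B (κ u′) (κ T)) (δ-refl u′) ⟨
        δ u′ T * lam (κ u′) + (ω u′ + δ u′ u′ * ω u) * B (κ u′) (κ T)
          ≡⟨ cong (λ R → δ R T * lam (κ R) + (ω R + δ R u′ * ω u) * B (κ R) (κ T)) R≡u′ ⟨
        δ R T * lam (κ R) + (ω R + δ R u′ * ω u) * B (κ R) (κ T)
          ≡⟨ cong (λ d → d * lam (κ R) + (ω R + δ R u′ * ω u) * B (κ R) (κ T)) δ-minor ⟩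
        lift κ′ ω′ r t ∎
        where collect : ∀ d L L′ a c b → d * L + a * b + (+ 0 * L′ + c * b) ≡ d * L + (a + + 1 * c) * b
              collect = solve-∀
      row (no R≢u′) = begin
        A₂ R T
          ≡⟨ addRow-≢ A₁ u′ u T R≢u′ ⟩
        A₁ R T
          ≡⟨ setColumn-≢ A u unitDiff R T≢u ⟩
        δ R T * lam (κ R) + ω R * B (κ R) (κ T)
          ≡⟨ cong₂ (λ d w → d * lam (κ R) + w * B (κ R) (κ T)) δ-minor (sym ω′≡ω) ⟩
        lift κ′ ω′ r t ∎
        where ω′≡ω : ω′ r ≡ ω R
              ω′≡ω = begin
                ω R + δ R u′ * ω u  ≡⟨ cong (λ d → ω R + d * ω u) (δ-≢ R≢u′) ⟩
                ω R + + 0 * ω u     ≡⟨ cong (_+_ (ω R)) (ℤ.*-zeroˡ (ω u)) ⟩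
                ω R + + 0           ≡⟨ ℤ.+-identityʳ (ω R) ⟩
                ω R                 ∎

    det-merge : det (suc m) (lift κ ω) ≡ lam (κ u) * det m (lift κ′ ω′)
    det-merge = begin
      det (suc m) A                                               ≡⟨ det-subColumn m A (u≢u′ ∘ sym) ⟨
      det (suc m) (setColumn A u (λ r → A r u - A r u′))          ≡⟨ det-setColumn-cong (suc m) A u column-difference ⟩
      det (suc m) (setColumn A u (λ r → lam (κ u) * unitDiff r))  ≡⟨ det-setColumn-* m A u (lam (κ u)) unitDiff ⟩
      lam (κ u) * det (suc m) A₁                                  ≡⟨ cong (lam (κ u) *_) (det-addRow m A₁ u≢u′) ⟨
      lam (κ u) * det (suc m) A₂                                  ≡⟨ cong (lam (κ u) *_) (det-unitColumn m A₂ u unit-column) ⟩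
      lam (κ u) * det m (minor A₂ u u)                            ≡⟨ cong (lam (κ u) *_) (det-cong m minor-A₂) ⟩
      lam (κ u) * det m (lift κ′ ω′)                              ∎

    fiberSum-merge : ∀ c → fiberSum κ′ ω′ c ≡ fiberSum κ ω c
    fiberSum-merge c = begin
      ∑[ t < m ] (δ (κ′ t) c * (ω (punchIn u t) + δ (punchIn u t) u′ * ω u))
        ≡⟨ sum-cong-≗ (λ t → ℤ.*-distribˡ-+ (δ (κ′ t) c) (ω (punchIn u t)) _) ⟩
      ∑[ t < m ] (δ (κ′ t) c * ω (punchIn u t) + moved t)
        ≡⟨ ∑-distrib-+ (λ t → δ (κ′ t) c * ω (punchIn u t)) moved ⟩
      rest + ∑[ t < m ] moved t
        ≡⟨ cong (_+_ rest) (sum-single moved t′ movedElsewhere) ⟩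
      rest + moved t′
        ≡⟨ cong (_+_ rest) movedAt ⟩
      rest + δ (κ u) c * ω u
        ≡⟨ ℤ.+-comm rest _ ⟩
      δ (κ u) c * ω u + rest
        ≡⟨ sum-remove {i = u} (λ v → δ (κ v) c * ω v) ⟨
      fiberSum κ ω c ∎
      where
      rest : ℤ
      rest = ∑[ t < m ] (δ (κ′ t) c * ω (punchIn u t))
      moved : Fin m → ℤ
      moved t = δ (κ′ t) c * (δ (punchIn u t) u′ * ω u)
      movedElsewhere : ∀ t → t ≢ t′ → moved t ≡ + 0
      movedElsewhere t t≢t′ = begin
        δ (κ′ t) c * (δ (punchIn u t) u′ * ω u)
          ≡⟨ cong (λ d → δ (κ′ t) c * (d * ω u))
                  (δ-≢ (λ eq → t≢t′ (Fin.punchIn-injective u t t′ (trans eq (sym punchIn-t′))))) ⟩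
        δ (κ′ t) c * (+ 0 * ω u)  ≡⟨ cong (δ (κ′ t) c *_) (ℤ.*-zeroˡ (ω u)) ⟩
        δ (κ′ t) c * + 0          ≡⟨ ℤ.*-zeroʳ (δ (κ′ t) c) ⟩
        + 0                       ∎
      movedAt : moved t′ ≡ δ (κ u) c * ω u
      movedAt = begin
        δ (κ (punchIn u t′)) c * (δ (punchIn u t′) u′ * ω u)
          ≡⟨ cong (λ v → δ (κ v) c * (δ v u′ * ω u)) punchIn-t′ ⟩
        δ (κ u′) c * (δ u′ u′ * ω u)
          ≡⟨ cong₂ (λ a d → δ a c * (d * ω u)) (sym κu≡κu′) (δ-refl u′) ⟩
        δ (κ u) c * (+ 1 * ω u)
          ≡⟨ cong (δ (κ u) c *_) (ℤ.*-identityˡ (ω u)) ⟩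
        δ (κ u) c * ω u ∎

    fiberSize-merge : ∀ c → fiberSize κ c ≡ δℕ (κ u) c ℕ.+ fiberSize κ′ c
    fiberSize-merge c = ℕΣ.sum-remove {i = u} (λ v → δℕ (κ v) c)

    fiberSize-merge-positive : ∃ λ s → fiberSize κ′ (κ u) ≡ suc s
    fiberSize-merge-positive = sumℕ-positive (λ t → δℕ (κ′ t) (κ u)) t′
      (trans (cong (λ c → δℕ c (κ u)) (trans (cong κ punchIn-t′) (sym κu≡κu′))) (δℕ-refl (κ u)))

    fiberFactor-merge : fiberFactor κ ≡ lam (κ u) * fiberFactor κ′
    fiberFactor-merge = product-factorAt (λ c → lam c ^ (fiberSize κ c ∸ 1)) (λ c → lam c ^ (fiberSize κ′ c ∸ 1))
      (κ u) (lam (κ u)) unchanged atMerged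
      where
      s : ℕ
      s = proj₁ fiberSize-merge-positive
      unchanged : ∀ c → c ≢ κ u → lam c ^ (fiberSize κ c ∸ 1) ≡ lam c ^ (fiberSize κ′ c ∸ 1)
      unchanged c c≢κu = cong (λ z → lam c ^ (z ∸ 1)) (trans (fiberSize-merge c) (cong (ℕ._+ fiberSize κ′ c) (δℕ-≢ (c≢κu ∘ sym))))
      atMerged : lam (κ u) ^ (fiberSize κ (κ u) ∸ 1) ≡ lam (κ u) * lam (κ u) ^ (fiberSize κ′ (κ u) ∸ 1)
      atMerged = begin
        lam (κ u) ^ (fiberSize κ (κ u) ∸ 1)
          ≡⟨ cong (λ z → lam (κ u) ^ (z ∸ 1)) (trans (fiberSize-merge (κ u)) (cong₂ ℕ._+_ (δℕ-refl (κ u)) (proj₂ fiberSize-merge-positive))) ⟩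
        lam (κ u) ^ suc s
          ≡⟨ cong (λ z → lam (κ u) * lam (κ u) ^ (z ∸ 1)) (proj₂ fiberSize-merge-positive) ⟨
        lam (κ u) * lam (κ u) ^ (fiberSize κ′ (κ u) ∸ 1) ∎

    surjective-merge : StrictlySurjective _≡_ κ → StrictlySurjective _≡_ κ′
    surjective-merge κ-onto c with v , κv≡c ← κ-onto c with u ≟ v
    ... | yes refl = t′ , trans (cong κ punchIn-t′) (trans (sym κu≡κu′) κv≡c)
    ... | no u≢v   = punchOut u≢v , trans (cong κ (Fin.punchIn-punchOut u≢v)) κv≡c

  det-lift : ∀ m (κ : Fin m → Fin k) ω → StrictlySurjective _≡_ κ →
    det m (lift κ ω) ≡ fiberFactor κ * det k (quotient (fiberSum κ ω))
  det-lift m κ ω κ-onto with Fin.any? (λ u → Fin.any? (λ u′ → ¬? (u ≟ u′) ×-dec (κ u ≟ κ u′)))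
  det-lift (suc m) κ ω κ-onto | yes (u , u′ , u≢u′ , κu≡κu′) = begin
    det (suc m) (lift κ ω)
      ≡⟨ det-merge ⟩
    lam (κ u) * det m (lift κ′ ω′)
      ≡⟨ cong (lam (κ u) *_) (det-lift m κ′ ω′ (surjective-merge κ-onto)) ⟩
    lam (κ u) * (fiberFactor κ′ * det k (quotient (fiberSum κ′ ω′)))
      ≡⟨ cong (λ d → lam (κ u) * (fiberFactor κ′ * d)) (det-cong k (λ c d → cong (λ w → δ c d * lam c + w * B c d) (fiberSum-merge c))) ⟩
    lam (κ u) * (fiberFactor κ′ * det k (quotient (fiberSum κ ω)))
      ≡⟨ ℤ.*-assoc (lam (κ u)) (fiberFactor κ′) _ ⟨
    lam (κ u) * fiberFactor κ′ * det k (quotient (fiberSum κ ω))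
      ≡⟨ cong (_* det k (quotient (fiberSum κ ω))) fiberFactor-merge ⟨
    fiberFactor κ * det k (quotient (fiberSum κ ω)) ∎
    where open Merge κ ω u≢u′ κu≡κu′
  det-lift m κ ω κ-onto | no noCollision = det-lift-bijective m κ ω κ-inj κ-onto
    where
    κ-inj : Injective _≡_ _≡_ κ
    κ-inj {u} {u′} κu≡κu′ with u ≟ u′
    ... | yes u≡u′ = u≡u′
    ... | no  u≢u′ = ⊥-elim (noCollision (u , u′ , u≢u′ , κu≡κu′))

quotient-lift : ∀ {k k′} (lam : Fin k → ℤ) (B : Matrix k) (lam′ : Fin k′ → ℤ) (B′ : Matrix k′)
  (ρ : Fin k → Fin k′) (W : Fin k → ℤ) →
  (∀ c → lam c + W c * B c c ≡ lam′ (ρ c) + W c * B′ (ρ c) (ρ c)) →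
  (∀ c d → c ≢ d → B c d ≡ B′ (ρ c) (ρ d)) →
  ∀ c d → Lumping.quotient lam B W c d ≡ Lumping.lift lam′ B′ ρ W c d
quotient-lift lam B lam′ B′ ρ W diagonal offDiagonal c d = byEquality (c ≟ d)
  where
  byEquality : Dec (c ≡ d) → Lumping.quotient lam B W c d ≡ Lumping.lift lam′ B′ ρ W c d
  byEquality (yes refl) = begin
    δ c c * lam c + W c * B c c                ≡⟨ cong (λ e → e * lam c + W c * B c c) (δ-refl c) ⟩
    + 1 * lam c + W c * B c c                  ≡⟨ cong (_+ W c * B c c) (ℤ.*-identityˡ (lam c)) ⟩
    lam c + W c * B c c                        ≡⟨ diagonal c ⟩
    lam′ (ρ c) + W c * B′ (ρ c) (ρ c)          ≡⟨ cong (_+ W c * B′ (ρ c) (ρ c)) (ℤ.*-identityˡ (lam′ (ρ c))) ⟨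
    + 1 * lam′ (ρ c) + W c * B′ (ρ c) (ρ c)    ≡⟨ cong (λ e → e * lam′ (ρ c) + W c * B′ (ρ c) (ρ c)) (δ-refl c) ⟨
    δ c c * lam′ (ρ c) + W c * B′ (ρ c) (ρ c)  ∎
  byEquality (no c≢d) = begin
    δ c d * lam c + W c * B c d                ≡⟨ cong₂ (λ e b → e * lam c + W c * b) (δ-≢ c≢d) (offDiagonal c d c≢d) ⟩
    + 0 * lam c + W c * B′ (ρ c) (ρ d)         ≡⟨ cong (_+ W c * B′ (ρ c) (ρ d)) (trans (ℤ.*-zeroˡ (lam c)) (sym (ℤ.*-zeroˡ (lam′ (ρ c))))) ⟩
    + 0 * lam′ (ρ c) + W c * B′ (ρ c) (ρ d)    ≡⟨ cong (λ e → e * lam′ (ρ c) + W c * B′ (ρ c) (ρ d)) (δ-≢ c≢d) ⟨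
    δ c d * lam′ (ρ c) + W c * B′ (ρ c) (ρ d)  ∎

-- Distances

anyFin-true : ∀ m (f : Fin m → Bool) w → f w ≡ true → anyFin m f ≡ true
anyFin-true (suc m) f zero    fw≡true = cong (_∨ anyFin m (f ∘ suc)) fw≡true
anyFin-true (suc m) f (suc w) fw≡true =
  trans (cong (f zero ∨_) (anyFin-true m (f ∘ suc) w fw≡true)) (Bool.∨-zeroʳ (f zero))

anyFin-false : ∀ m (f : Fin m → Bool) → (∀ w → f w ≡ false) → anyFin m f ≡ false
anyFin-false zero    f f≡false = refl
anyFin-false (suc m) f f≡false = cong₂ _∨_ (f≡false zero) (anyFin-false m (f ∘ suc) (f≡false ∘ suc))

maxFin-lub : ∀ m (f : Fin m → ℕ) {K} → (∀ v → f v ≤ K) → maxFin m f ≤ K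
maxFin-lub zero    f f≤K = z≤n
maxFin-lub (suc m) f f≤K = ℕ.⊔-lub (f≤K zero) (maxFin-lub m (f ∘ suc) (f≤K ∘ suc))

maxFin-upper : ∀ m (f : Fin m → ℕ) w → f w ≤ maxFin m f
maxFin-upper (suc m) f zero    = ℕ.m≤m⊔n (f zero) _
maxFin-upper (suc m) f (suc w) = ℕ.≤-trans (maxFin-upper m (f ∘ suc) w) (ℕ.m≤n⊔m (f zero) _)

maxFin-attained : ∀ m (f : Fin m → ℕ) {K} w → (∀ v → f v ≤ K) → f w ≡ K → maxFin m f ≡ K
maxFin-attained m f w f≤K fw≡K = ℕ.≤-antisym (maxFin-lub m f f≤K) (subst (_≤ maxFin m f) fw≡K (maxFin-upper m f w))

module _ {m} (A : Fin m → Fin m → Bool) where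

  reach₁-adjacent : ∀ {u v} → A u v ≡ true → reach A 1 u v ≡ true
  reach₁-adjacent {u} {v} Auv = trans (cong (⌊ u ≟ v ⌋ ∨_) (anyFin-true m _ u via-u)) (Bool.∨-zeroʳ _)
    where via-u : ⌊ u ≟ u ⌋ ∧ A u v ≡ true
          via-u = trans (cong (_∧ A u v) (isYes-true (u ≟ u) refl)) Auv

  reach₁-nonadjacent : ∀ {u v} → u ≢ v → A u v ≡ false → reach A 1 u v ≡ false
  reach₁-nonadjacent {u} {v} u≢v Auv = cong₂ _∨_ (isYes-false (u ≟ v) u≢v) (anyFin-false m _ not-via)
    where not-via : ∀ w → ⌊ u ≟ w ⌋ ∧ A w v ≡ false
          not-via w with u ≟ w
          ... | yes refl = Auv
          ... | no  _    = refl

leastTrue-0 : ∀ F (f : ℕ → Bool) → f 0 ≡ true → leastTrue (suc F) f ≡ 0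
leastTrue-0 F f f0 rewrite f0 = refl

leastTrue-1 : ∀ F (f : ℕ → Bool) → f 0 ≡ false → f 1 ≡ true → leastTrue (suc (suc F)) f ≡ 1
leastTrue-1 F f f0 f1 rewrite f0 | f1 = refl

leastTrue-2 : ∀ F (f : ℕ → Bool) → f 0 ≡ false → f 1 ≡ false → f 2 ≡ true → leastTrue (suc (suc (suc F))) f ≡ 2
leastTrue-2 F f f0 f1 f2 rewrite f0 | f1 | f2 = refl

module _ {F} (A : Fin (suc (suc (suc F))) → Fin (suc (suc (suc F))) → Bool) where

  dist-self : ∀ u → dist A u u ≡ 0
  dist-self u = leastTrue-0 (suc (suc F)) (λ k → reach A k u u) (isYes-true (u ≟ u) refl)

  dist-adjacent : ∀ {u v} → u ≢ v → A u v ≡ true → dist A u v ≡ 1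
  dist-adjacent {u} {v} u≢v Auv =
    leastTrue-1 (suc F) (λ k → reach A k u v) (isYes-false (u ≟ v) u≢v) (reach₁-adjacent A Auv)

  dist-commonNeighbour : ∀ {u v} w → u ≢ v → A u v ≡ false → A u w ≡ true → A w v ≡ true → dist A u v ≡ 2
  dist-commonNeighbour {u} {v} w u≢v Auv Auw Awv =
    leastTrue-2 F (λ k → reach A k u v) (isYes-false (u ≟ v) u≢v) (reach₁-nonadjacent A u≢v Auv)
      (trans (cong (_∨ anyFin _ (λ w → reach A 1 u w ∧ A w v)) (reach₁-nonadjacent A u≢v Auv))
             (anyFin-true _ (λ w → reach A 1 u w ∧ A w v) w (cong₂ _∧_ (reach₁-adjacent A Auw) Awv)))

-- The graph H ∖ e

-- adjG is this formula applied to (u ≟ v), the blocks of u and v, and whether u, v are the endpoints p, q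
edgeFormula : ∀ {k} → Bool → Fin (suc k) → Fin (suc k) → Bool → Bool → Bool → Bool → Bool
edgeFormula same β β′ pu qu pv qv = (not same ∧ (isC β ∨ isC β′ ∨ ⌊ β ≟ β′ ⌋)) ∧ not ((pu ∧ qv) ∨ (qu ∧ pv))

-- eccMatrix A u v is eccEntry (dist A u v) (ecc A u) (ecc A v)
eccEntry : ℕ → ℕ → ℕ → ℤ
eccEntry d e e′ = if ⌊ d ℕ.≟ (e ⊓ e′) ⌋ then + d else + 0

oneOrTwo : Bool → ℕ
oneOrTwo b = if b then 1 else 2

eccEntry-diameterTwo : ∀ cu cv adj → (cu ∨ cv ≡ true → adj ≡ true) →
  eccEntry (oneOrTwo adj) (oneOrTwo cu) (oneOrTwo cv) ≡ + (if cu ∨ cv then 1 else if adj then 0 else 2)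
eccEntry-diameterTwo true  cv    adj   central rewrite central refl with cv
... | true  = refl
... | false = refl
eccEntry-diameterTwo false true  adj   central rewrite central refl = refl
eccEntry-diameterTwo false false true  central = refl
eccEntry-diameterTwo false false false central = refl

false≢true : false ≢ true
false≢true ()

oneOrTwo-mono : ∀ a c → (c ≡ true → a ≡ true) → oneOrTwo a ≤ oneOrTwo c
oneOrTwo-mono a     true  c⇒a rewrite c⇒a refl = s≤s z≤n
oneOrTwo-mono true  false _   = s≤s z≤n
oneOrTwo-mono false false _   = s≤s (s≤s z≤n)

-- Groups: 0 = {p, q}, 1 = C, 2 = the rest of the block of e, 3 = the other blocks.
-- N and L stand for n and l, as integers the ring solver can treat as variables.
ε₄ : Fin 4 → Fin 4 → ℕ
ε₄ (suc zero)       _                = 1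
ε₄ _                (suc zero)       = 1
ε₄ zero             (suc (suc zero)) = 0
ε₄ (suc (suc zero)) zero             = 0
ε₄ (suc (suc zero)) (suc (suc zero)) = 0
ε₄ _                _                = 2

lam₄ : ℤ → ℤ → Fin 4 → ℤ
lam₄ x N zero                   = x + + 2
lam₄ x N (suc zero)             = x + + 1
lam₄ x N (suc (suc zero))       = x + + 0
lam₄ x N (suc (suc (suc zero))) = x + + 2 * N

W₄ : ℤ → ℤ → Fin 4 → ℤ
W₄ N L zero                   = + 2
W₄ N L (suc zero)             = N
W₄ N L (suc (suc zero))       = N - + 2
W₄ N L (suc (suc (suc zero))) = (L - + 1) * N

B₄ : Matrix 4
B₄ c d = - + ε₄ c d

det-quotient₄ : ∀ n l x → det 4 (Lumping.quotient (lam₄ x (+ n)) B₄ (W₄ (+ n) (+ l))) ≡ quartic n l x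
det-quotient₄ n l x = expansion x (+ n) (+ l)
  where
  -- det 4 of the quotient unfolded by definition, and x ^ k spelled out: the ring solver unfolds neither
  expansion : ∀ x N L →
    + 1 * (+ 1 * (x + + 2) + + 2 * - + 2) * (+ 1 * (+ 1 * (x + + 1) + N * - + 1) * (+ 1 * (+ 1 * (x
    + + 0) + (N - + 2) * - + 0) * (+ 1 * (+ 1 * (x + + 2 * N) + (L - + 1) * N * - + 2) * (+ 1) + + 0)
    + ((- + 1) * (+ 0 * (x + + 0) + (N - + 2) * - + 2) * (+ 1 * (+ 0 * (x + + 2 * N) + (L - + 1) * N *
    - + 2) * (+ 1) + + 0) + + 0)) + ((- + 1) * (+ 0 * (x + + 1) + N * - + 1) * (+ 1 * (+ 0 * (x + + 0)
    + (N - + 2) * - + 1) * (+ 1 * (+ 1 * (x + + 2 * N) + (L - + 1) * N * - + 2) * (+ 1) + + 0)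
    + ((- + 1) * (+ 0 * (x + + 0) + (N - + 2) * - + 2) * (+ 1 * (+ 0 * (x + + 2 * N) + (L - + 1) * N *
    - + 1) * (+ 1) + + 0) + + 0)) + ((- - + 1) * (+ 0 * (x + + 1) + N * - + 1) * (+ 1 * (+ 0 * (x + + 0)
    + (N - + 2) * - + 1) * (+ 1 * (+ 0 * (x + + 2 * N) + (L - + 1) * N * - + 2) * (+ 1) + + 0)
    + ((- + 1) * (+ 1 * (x + + 0) + (N - + 2) * - + 0) * (+ 1 * (+ 0 * (x + + 2 * N) + (L - + 1) * N *
    - + 1) * (+ 1) + + 0) + + 0)) + + 0))) + ((- + 1) * (+ 0 * (x + + 2) + + 2 * - + 1) * (+ 1 * (+ 0 *
    (x + + 1) + N * - + 1) * (+ 1 * (+ 1 * (x + + 0) + (N - + 2) * - + 0) * (+ 1 * (+ 1 * (x + + 2 * N)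
    + (L - + 1) * N * - + 2) * (+ 1) + + 0) + ((- + 1) * (+ 0 * (x + + 0) + (N - + 2) * - + 2) * (+ 1 *
    (+ 0 * (x + + 2 * N) + (L - + 1) * N * - + 2) * (+ 1) + + 0) + + 0)) + ((- + 1) * (+ 0 * (x + + 1)
    + N * - + 1) * (+ 1 * (+ 0 * (x + + 0) + (N - + 2) * - + 0) * (+ 1 * (+ 1 * (x + + 2 * N) + (L
    - + 1) * N * - + 2) * (+ 1) + + 0) + ((- + 1) * (+ 0 * (x + + 0) + (N - + 2) * - + 2) * (+ 1 * (+ 0
    * (x + + 2 * N) + (L - + 1) * N * - + 2) * (+ 1) + + 0) + + 0)) + ((- - + 1) * (+ 0 * (x + + 1) + N
    * - + 1) * (+ 1 * (+ 0 * (x + + 0) + (N - + 2) * - + 0) * (+ 1 * (+ 0 * (x + + 2 * N) + (L - + 1) *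
    N * - + 2) * (+ 1) + + 0) + ((- + 1) * (+ 1 * (x + + 0) + (N - + 2) * - + 0) * (+ 1 * (+ 0 * (x
    + + 2 * N) + (L - + 1) * N * - + 2) * (+ 1) + + 0) + + 0)) + + 0))) + ((- - + 1) * (+ 0 * (x + + 2)
    + + 2 * - + 0) * (+ 1 * (+ 0 * (x + + 1) + N * - + 1) * (+ 1 * (+ 0 * (x + + 0) + (N - + 2) * - + 1)
    * (+ 1 * (+ 1 * (x + + 2 * N) + (L - + 1) * N * - + 2) * (+ 1) + + 0) + ((- + 1) * (+ 0 * (x + + 0)
    + (N - + 2) * - + 2) * (+ 1 * (+ 0 * (x + + 2 * N) + (L - + 1) * N * - + 1) * (+ 1) + + 0) + + 0))
    + ((- + 1) * (+ 1 * (x + + 1) + N * - + 1) * (+ 1 * (+ 0 * (x + + 0) + (N - + 2) * - + 0) * (+ 1 *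
    (+ 1 * (x + + 2 * N) + (L - + 1) * N * - + 2) * (+ 1) + + 0) + ((- + 1) * (+ 0 * (x + + 0) + (N
    - + 2) * - + 2) * (+ 1 * (+ 0 * (x + + 2 * N) + (L - + 1) * N * - + 2) * (+ 1) + + 0) + + 0))
    + ((- - + 1) * (+ 0 * (x + + 1) + N * - + 1) * (+ 1 * (+ 0 * (x + + 0) + (N - + 2) * - + 0) * (+ 1 *
    (+ 0 * (x + + 2 * N) + (L - + 1) * N * - + 1) * (+ 1) + + 0) + ((- + 1) * (+ 0 * (x + + 0) + (N
    - + 2) * - + 1) * (+ 1 * (+ 0 * (x + + 2 * N) + (L - + 1) * N * - + 2) * (+ 1) + + 0) + + 0))
    + + 0))) + ((- - - + 1) * (+ 0 * (x + + 2) + + 2 * - + 2) * (+ 1 * (+ 0 * (x + + 1) + N * - + 1) *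
    (+ 1 * (+ 0 * (x + + 0) + (N - + 2) * - + 1) * (+ 1 * (+ 0 * (x + + 2 * N) + (L - + 1) * N * - + 2)
    * (+ 1) + + 0) + ((- + 1) * (+ 1 * (x + + 0) + (N - + 2) * - + 0) * (+ 1 * (+ 0 * (x + + 2 * N) + (L
    - + 1) * N * - + 1) * (+ 1) + + 0) + + 0)) + ((- + 1) * (+ 1 * (x + + 1) + N * - + 1) * (+ 1 * (+ 0
    * (x + + 0) + (N - + 2) * - + 0) * (+ 1 * (+ 0 * (x + + 2 * N) + (L - + 1) * N * - + 2) * (+ 1)
    + + 0) + ((- + 1) * (+ 1 * (x + + 0) + (N - + 2) * - + 0) * (+ 1 * (+ 0 * (x + + 2 * N) + (L - + 1)
    * N * - + 2) * (+ 1) + + 0) + + 0)) + ((- - + 1) * (+ 0 * (x + + 1) + N * - + 1) * (+ 1 * (+ 0 * (x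
    + + 0) + (N - + 2) * - + 0) * (+ 1 * (+ 0 * (x + + 2 * N) + (L - + 1) * N * - + 1) * (+ 1) + + 0)
    + ((- + 1) * (+ 0 * (x + + 0) + (N - + 2) * - + 1) * (+ 1 * (+ 0 * (x + + 2 * N) + (L - + 1) * N *
    - + 2) * (+ 1) + + 0) + + 0)) + + 0))) + + 0)))
    ≡ (x * (x * (x * (x * + 1))))
      - (+ 2 * N * L - + 3 * N + + 1) * (x * (x * (x * + 1)))
      - (+ 2 * N - + 2 * N * L + + 3 * L * (N * (N * + 1)) + + 2) * (x * (x * + 1))
      + (+ 4 * N - + 12 * L * N + + 2 * L * (N * (N * + 1))
         + + 2 * L * (N * (N * (N * + 1))) + + 4 * (N * (N * + 1)) - + 4 * (N * (N * (N * + 1)))) * x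
      + + 16 * N - + 24 * (N * (N * + 1)) + + 8 * (N * (N * (N * + 1)))
      - + 16 * L * N + + 16 * L * (N * (N * + 1)) - + 4 * L * (N * (N * (N * + 1)))
  expansion = solve-∀

factorisedCharPoly : ℕ → ℕ → ℤ → ℤ
factorisedCharPoly n l x = (x + + 1) ^ (n ∸ 1) * (x + + 2) * x ^ ((n ∸ 3) ℕ.+ (n ∸ 1) ℕ.* (l ∸ 1))
                           * (x + + (2 ℕ.* n)) ^ (l ∸ 2) * quartic n l x

CharPolyFormula : ℕ → ℕ → Set
CharPolyFormula n l = (b : Fin l) (p q : Fin n) → p ≢ q → (x : ℤ) →
  charPolyAt (eccMatrix (adjG n l b p q)) x ≡ factorisedCharPoly n l x

module RemovedEdge (n′ l′ : ℕ) where

  n : ℕ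
  n = suc (suc (suc n′))

  l : ℕ
  l = suc (suc l′)

  Vertex : Set
  Vertex = Fin (suc l ℕ.* n)

  -- class 0 is the endpoint p, class 1 the endpoint q, and class 2 + β the rest of block β (block 0 is C)
  Class : Set
  Class = Fin (suc (suc (suc l)))

  centre : Vertex
  centre = zero

  block-combine : ∀ β π → block l n (combine β π) ≡ β
  block-combine β π = cong proj₁ (Fin.remQuot-combine {suc l} {n} β π)

  anotherVertex : ∀ (u : Vertex) → ∃ λ w → u ≢ w
  anotherVertex zero    = suc zero , λ ()
  anotherVertex (suc _) = zero , λ ()

  anotherBlock : ∀ (β : Fin l) → ∃ λ β′ → β′ ≢ β
  anotherBlock zero    = suc zero , λ ()
  anotherBlock (suc _) = zero , λ ()

  module _ (b : Fin l) {p q : Fin n} (p≢q : p ≢ q) where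

    G : Vertex → Vertex → Bool
    G = adjG n l b p q

    classOf : Vertex → Class
    classOf v = if isVertex n l b p v then zero
                else if isVertex n l b q v then suc zero
                else suc (suc (block l n v))

    blockOf : Class → Fin (suc l)
    blockOf zero          = suc b
    blockOf (suc zero)    = suc b
    blockOf (suc (suc β)) = β

    isP : Class → Bool
    isP zero    = true
    isP (suc _) = false

    isQ : Class → Bool
    isQ zero          = false
    isQ (suc zero)    = true
    isQ (suc (suc _)) = false

    inC : Class → Bool
    inC = isC ∘ blockOf

    classAdjacent : Class → Class → Bool
    classAdjacent c d = edgeFormula false (blockOf c) (blockOf d) (isP c) (isQ c) (isP d) (isQ d)

    isVertex-true : ∀ r v → isVertex n l b r v ≡ true → block l n v ≡ suc b × pos l n v ≡ r
    isVertex-true r v isr with block l n v ≟ suc b | pos l n v ≟ r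
    isVertex-true r v refl | yes β≡ | yes π≡ = β≡ , π≡
    isVertex-true r v ()   | yes _  | no _
    isVertex-true r v ()   | no _   | _

    blockOf-classOf : ∀ v → blockOf (classOf v) ≡ block l n v
    blockOf-classOf v with isVertex n l b p v in isp
    ... | true  = sym (proj₁ (isVertex-true p v isp))
    ... | false with isVertex n l b q v in isq
    ...   | true  = sym (proj₁ (isVertex-true q v isq))
    ...   | false = refl

    isP-classOf : ∀ v → isP (classOf v) ≡ isVertex n l b p v
    isP-classOf v with isVertex n l b p v
    ... | true  = refl
    ... | false with isVertex n l b q v
    ...   | true  = refl
    ...   | false = refl

    isQ-classOf : ∀ v → isQ (classOf v) ≡ isVertex n l b q v
    isQ-classOf v with isVertex n l b p v in isp
    ... | true  = sym (trans (cong (⌊ block l n v ≟ suc b ⌋ ∧_)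
                                   (isYes-false (pos l n v ≟ q) (p≢q ∘ trans (sym (proj₂ (isVertex-true p v isp))))))
                             (Bool.∧-zeroʳ _))
    ... | false with isVertex n l b q v
    ...   | true  = refl
    ...   | false = refl

    adjG-classOf : ∀ u v → u ≢ v → G u v ≡ classAdjacent (classOf u) (classOf v)
    adjG-classOf u v u≢v = edgeFormula-cong (isYes-false (u ≟ v) u≢v)
      (blockOf-classOf u) (blockOf-classOf v) (isP-classOf u) (isQ-classOf u) (isP-classOf v) (isQ-classOf v)
      where
      edgeFormula-cong : ∀ {s s′ β₁ β₁′ β₂ β₂′ a a′ b b′ c c′ d d′} → s ≡ s′ → β₁′ ≡ β₁ → β₂′ ≡ β₂ →
        a′ ≡ a → b′ ≡ b → c′ ≡ c → d′ ≡ d → edgeFormula {l} s β₁ β₂ a b c d ≡ edgeFormula s′ β₁′ β₂′ a′ b′ c′ d′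
      edgeFormula-cong refl refl refl refl refl refl refl = refl

    classAdjacent-centreˡ : ∀ c d → inC c ≡ true → classAdjacent c d ≡ true
    classAdjacent-centreˡ (suc (suc zero)) d _ = refl

    classAdjacent-centreʳ : ∀ c d → inC d ≡ true → classAdjacent c d ≡ true
    classAdjacent-centreʳ c (suc (suc zero)) _
      rewrite Bool.∨-zeroʳ (isC (blockOf c)) | Bool.∧-zeroʳ (isP c) | Bool.∧-zeroʳ (isQ c) = refl

    classAdjacent-apart : ∀ c d → inC c ≡ false → inC d ≡ false → blockOf c ≢ blockOf d → classAdjacent c d ≡ false
    classAdjacent-apart c d c∉C d∉C apart rewrite c∉C | d∉C | isYes-false (blockOf c ≟ blockOf d) apart = refl

    centre∈C : inC (classOf centre) ≡ true
    centre∈C = cong isC (blockOf-classOf centre)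

    dist-class : ∀ {u v} → u ≢ v → dist G u v ≡ oneOrTwo (classAdjacent (classOf u) (classOf v))
    dist-class {u} {v} u≢v = byAdjacency _ refl
      where
      byAdjacency : ∀ a → classAdjacent (classOf u) (classOf v) ≡ a → dist G u v ≡ oneOrTwo a
      byAdjacency true  adj = dist-adjacent G u≢v (trans (adjG-classOf u v u≢v) adj)
      byAdjacency false adj = dist-commonNeighbour G centre u≢v (trans (adjG-classOf u v u≢v) adj)
          (trans (adjG-classOf u centre (λ u≡c → u∉C (trans (cong (inC ∘ classOf) u≡c) centre∈C)))
                 (classAdjacent-centreʳ (classOf u) (classOf centre) centre∈C))
          (trans (adjG-classOf centre v (λ c≡v → v∉C (trans (cong (inC ∘ classOf) (sym c≡v)) centre∈C)))
                 (classAdjacent-centreˡ (classOf centre) (classOf v) centre∈C))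
        where
        u∉C : inC (classOf u) ≢ true
        u∉C u∈C with () ← trans (sym adj) (classAdjacent-centreˡ (classOf u) (classOf v) u∈C)
        v∉C : inC (classOf v) ≢ true
        v∉C v∈C with () ← trans (sym adj) (classAdjacent-centreʳ (classOf u) (classOf v) v∈C)

    dist-bound : ∀ u v → dist G u v ≤ oneOrTwo (inC (classOf u))
    dist-bound u v = byEquality (u ≟ v)
      where
      byEquality : Dec (u ≡ v) → dist G u v ≤ oneOrTwo (inC (classOf u))
      byEquality (yes refl) = subst (_≤ oneOrTwo (inC (classOf u))) (sym (dist-self G u)) z≤n
      byEquality (no u≢v)   = subst (_≤ oneOrTwo (inC (classOf u))) (sym (dist-class u≢v))
                                    (oneOrTwo-mono _ _ (classAdjacent-centreˡ (classOf u) (classOf v)))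

    eccentricVertex : ∀ u → ∃ λ w → dist G u w ≡ oneOrTwo (inC (classOf u))
    eccentricVertex u = byCentre _ refl
      where
      byCentre : ∀ c → inC (classOf u) ≡ c → ∃ λ w → dist G u w ≡ oneOrTwo c
      byCentre true  u∈C = w , trans (dist-class u≢w) (cong oneOrTwo (classAdjacent-centreˡ (classOf u) (classOf w) u∈C))
        where
        w : Vertex
        w = proj₁ (anotherVertex u)
        u≢w : u ≢ w
        u≢w = proj₂ (anotherVertex u)
      byCentre false u∉C = outsideC (block l n u) (blockOf-classOf u)
        where
        outsideC : ∀ β → blockOf (classOf u) ≡ β → ∃ λ w → dist G u w ≡ 2
        outsideC zero    blockOf≡ = ⊥-elim (false≢true (trans (sym u∉C) (cong isC blockOf≡)))
        outsideC (suc β) blockOf≡ = w , trans (dist-class u≢w) (cong oneOrTwo apart)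
          where
          β′ : Fin l
          β′ = proj₁ (anotherBlock β)
          w : Vertex
          w = combine {suc l} {n} (suc β′) zero
          blockOf-w : blockOf (classOf w) ≡ suc β′
          blockOf-w = trans (blockOf-classOf w) (block-combine (suc β′) zero)
          different : blockOf (classOf u) ≢ blockOf (classOf w)
          different eq = proj₂ (anotherBlock β) (Fin.suc-injective (trans (sym blockOf-w) (trans (sym eq) blockOf≡)))
          u≢w : u ≢ w
          u≢w u≡w = different (cong (blockOf ∘ classOf) u≡w)
          apart : classAdjacent (classOf u) (classOf w) ≡ false
          apart = classAdjacent-apart (classOf u) (classOf w) u∉C (cong isC blockOf-w) different

    ecc-class : ∀ u → ecc G u ≡ oneOrTwo (inC (classOf u))
    ecc-class u = maxFin-attained _ (dist G u) (proj₁ (eccentricVertex u)) (dist-bound u) (proj₂ (eccentricVertex u))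

    centralAdjacent : ∀ c d → inC c ∨ inC d ≡ true → classAdjacent c d ≡ true
    centralAdjacent c d = byCentre (inC c) refl
      where
      byCentre : ∀ a → inC c ≡ a → a ∨ inC d ≡ true → classAdjacent c d ≡ true
      byCentre true  c∈C _       = classAdjacent-centreˡ c d c∈C
      byCentre false _   d∈C     = classAdjacent-centreʳ c d d∈C

    εClass : Class → Class → ℕ
    εClass c d = if inC c ∨ inC d then 1 else if classAdjacent c d then 0 else 2

    eccMatrix-class : ∀ {u v} → u ≢ v → eccMatrix G u v ≡ + εClass (classOf u) (classOf v)
    eccMatrix-class {u} {v} u≢v = begin
      eccEntry (dist G u v) (ecc G u) (ecc G v)
        ≡⟨ cong (λ d → eccEntry d (ecc G u) (ecc G v)) (dist-class u≢v) ⟩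
      eccEntry (oneOrTwo (classAdjacent (classOf u) (classOf v))) (ecc G u) (ecc G v)
        ≡⟨ cong₂ (eccEntry (oneOrTwo (classAdjacent (classOf u) (classOf v)))) (ecc-class u) (ecc-class v) ⟩
      eccEntry (oneOrTwo (classAdjacent (classOf u) (classOf v))) (oneOrTwo (inC (classOf u))) (oneOrTwo (inC (classOf v)))
        ≡⟨ eccEntry-diameterTwo (inC (classOf u)) (inC (classOf v)) _ (centralAdjacent (classOf u) (classOf v)) ⟩
      + εClass (classOf u) (classOf v) ∎

    eccMatrix-diagonal : ∀ u → eccMatrix G u u ≡ + 0
    eccMatrix-diagonal u = trans (cong (λ d → eccEntry d (ecc G u) (ecc G u)) (dist-self G u))
                                 (zeroEitherWay ⌊ 0 ℕ.≟ ecc G u ⊓ ecc G u ⌋)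
      where zeroEitherWay : ∀ c → (if c then + 0 else + 0) ≡ + 0
            zeroEitherWay true  = refl
            zeroEitherWay false = refl

    module Level₁ (x : ℤ) = Lumping (λ c → x + + εClass c c) (λ c d → - + εClass c d)

    ones : Vertex → ℤ
    ones _ = + 1

    charMatrix-lift : ∀ x i j → (if ⌊ i ≟ j ⌋ then x else + 0) - eccMatrix G i j ≡ Level₁.lift x classOf ones i j
    charMatrix-lift x i j = byEquality (i ≟ j)
      where
      e : ℤ
      e = + εClass (classOf i) (classOf j)
      byEquality : Dec (i ≡ j) → (if ⌊ i ≟ j ⌋ then x else + 0) - eccMatrix G i j ≡ Level₁.lift x classOf ones i j
      byEquality (yes refl) = begin
        (if ⌊ i ≟ i ⌋ then x else + 0) - eccMatrix G i i
          ≡⟨ cong₂ _-_ (cong (if_then x else + 0) (isYes-true (i ≟ i) refl)) (eccMatrix-diagonal i) ⟩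
        x - + 0
          ≡⟨ split x e ⟩
        + 1 * (x + e) + + 1 * - e
          ≡⟨ cong (λ d → d * (x + e) + + 1 * - e) (δ-refl i) ⟨
        Level₁.lift x classOf ones i i ∎
        where split : ∀ x e → x - + 0 ≡ + 1 * (x + e) + + 1 * - e
              split = solve-∀
      byEquality (no i≢j) = begin
        (if ⌊ i ≟ j ⌋ then x else + 0) - eccMatrix G i j
          ≡⟨ cong₂ _-_ (cong (if_then x else + 0) (isYes-false (i ≟ j) i≢j)) (eccMatrix-class i≢j) ⟩
        + 0 - e
          ≡⟨ split (x + + εClass (classOf i) (classOf i)) e ⟩
        + 0 * (x + + εClass (classOf i) (classOf i)) + + 1 * - e
          ≡⟨ cong (λ d → d * (x + + εClass (classOf i) (classOf i)) + + 1 * - e) (δ-≢ i≢j) ⟨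
        Level₁.lift x classOf ones i j ∎
        where split : ∀ L e → + 0 - e ≡ + 0 * L + + 1 * - e
              split = solve-∀

    classAt : Fin (suc l) → Fin n → Class
    classAt β π = if ⌊ β ≟ suc b ⌋ ∧ ⌊ π ≟ p ⌋ then zero
                  else if ⌊ β ≟ suc b ⌋ ∧ ⌊ π ≟ q ⌋ then suc zero
                  else suc (suc β)

    classOf-combine : ∀ β π → classOf (combine {suc l} {n} β π) ≡ classAt β π
    classOf-combine β π = cong₂ classAt (block-combine β π) (cong proj₂ (Fin.remQuot-combine {suc l} {n} β π))

    classAt-outside : ∀ β π → β ≢ suc b → classAt β π ≡ suc (suc β)
    classAt-outside β π β≢ rewrite isYes-false (β ≟ suc b) β≢ = refl

    classAt-block : ∀ β π γ → classAt β π ≡ suc (suc γ) → γ ≡ β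
    classAt-block β π γ = byCases (⌊ β ≟ suc b ⌋ ∧ ⌊ π ≟ p ⌋) (⌊ β ≟ suc b ⌋ ∧ ⌊ π ≟ q ⌋)
      where byCases : ∀ x y → (if x then zero else if y then suc zero else suc (suc β)) ≡ suc (suc γ) → γ ≡ β
            byCases false false refl = refl

    fiberSize-block : ∀ c β₀ → (∀ β π → β ≢ β₀ → δℕ (classAt β π) c ≡ 0) →
      fiberSize classOf c ≡ ℕΣ.sum (λ π → δℕ (classAt β₀ π) c)
    fiberSize-block c β₀ elsewhere = begin
      ℕΣ.sum (λ v → δℕ (classOf v) c)
        ≡⟨ ℕΣ.sum-combine (suc l) {n} (λ v → δℕ (classOf v) c) ⟩
      ℕΣ.sum (λ β → ℕΣ.sum (λ π → δℕ (classOf (combine {suc l} {n} β π)) c))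
        ≡⟨ ℕΣ.sum-cong-≗ (λ β → ℕΣ.sum-cong-≗ (λ π → cong (λ d → δℕ d c) (classOf-combine β π))) ⟩
      ℕΣ.sum (λ β → ℕΣ.sum (λ π → δℕ (classAt β π) c))
        ≡⟨ ℕΣ.sum-single (λ β → ℕΣ.sum (λ π → δℕ (classAt β π) c)) β₀
                          (λ β β≢β₀ → ℕΣ.sum-zero (λ π → δℕ (classAt β π) c) (λ π → elsewhere β π β≢β₀)) ⟩
      ℕΣ.sum (λ π → δℕ (classAt β₀ π) c) ∎

    δℕ-classAt-p : ∀ π → δℕ (classAt (suc b) π) zero ≡ δℕ π p
    δℕ-classAt-p π rewrite isYes-true (suc b ≟ suc b) refl with π ≟ p
    ... | yes _ = refl
    ... | no  _ with π ≟ q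
    ...   | yes _ = refl
    ...   | no  _ = refl

    δℕ-classAt-q : ∀ π → δℕ (classAt (suc b) π) (suc zero) ≡ δℕ π q
    δℕ-classAt-q π rewrite isYes-true (suc b ≟ suc b) refl with π ≟ p
    ... | yes refl rewrite isYes-false (p ≟ q) p≢q = refl
    ... | no  _ with π ≟ q
    ...   | yes _ = refl
    ...   | no  _ = refl

    δℕ-classAt-partition : ∀ π → δℕ (classAt (suc b) π) zero ℕ.+ δℕ (classAt (suc b) π) (suc zero)
                                   ℕ.+ δℕ (classAt (suc b) π) (suc (suc (suc b))) ≡ 1
    δℕ-classAt-partition π rewrite isYes-true (suc b ≟ suc b) refl with π ≟ p
    ... | yes _ = refl
    ... | no  _ with π ≟ q
    ...   | yes _ = refl
    ...   | no  _ rewrite isYes-true (suc (suc (suc b)) ≟ suc (suc (suc b))) refl = refl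

    size₁ : Class → ℕ
    size₁ zero          = 1
    size₁ (suc zero)    = 1
    size₁ (suc (suc β)) = if ⌊ β ≟ suc b ⌋ then suc n′ else n

    size₁-ownBlock : size₁ (suc (suc (suc b))) ≡ suc n′
    size₁-ownBlock = cong (if_then suc n′ else n) (isYes-true (suc b ≟ suc b) refl)

    size₁-otherBlock : ∀ {γ} → γ ≢ suc b → size₁ (suc (suc γ)) ≡ n
    size₁-otherBlock {γ} γ≢ = cong (if_then suc n′ else n) (isYes-false (γ ≟ suc b) γ≢)

    restOfOwnBlock : ℕΣ.sum (λ π → δℕ (classAt (suc b) π) (suc (suc (suc b)))) ≡ suc n′
    restOfOwnBlock = ℕ.+-cancelˡ-≡ 2 _ _ (begin
      2 ℕ.+ S
        ≡⟨ cong (ℕ._+ S) (cong₂ ℕ._+_ (trans (ℕΣ.sum-cong-≗ δℕ-classAt-p) (sum-δℕ p))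
                                      (trans (ℕΣ.sum-cong-≗ δℕ-classAt-q) (sum-δℕ q))) ⟨
      S₀ ℕ.+ S₁ ℕ.+ S
        ≡⟨ cong (ℕ._+ S) (ℕΣ.∑-distrib-+ (λ π → δℕ (classAt (suc b) π) zero) (λ π → δℕ (classAt (suc b) π) (suc zero))) ⟨
      ℕΣ.sum (λ π → δℕ (classAt (suc b) π) zero ℕ.+ δℕ (classAt (suc b) π) (suc zero)) ℕ.+ S
        ≡⟨ ℕΣ.∑-distrib-+ (λ π → δℕ (classAt (suc b) π) zero ℕ.+ δℕ (classAt (suc b) π) (suc zero))
                          (λ π → δℕ (classAt (suc b) π) (suc (suc (suc b)))) ⟨
      ℕΣ.sum (λ π → δℕ (classAt (suc b) π) zero ℕ.+ δℕ (classAt (suc b) π) (suc zero)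
                      ℕ.+ δℕ (classAt (suc b) π) (suc (suc (suc b))))
        ≡⟨ sumℕ-const _ 1 δℕ-classAt-partition ⟩
      n ℕ.* 1
        ≡⟨ ℕ.*-identityʳ n ⟩
      2 ℕ.+ suc n′ ∎)
      where
      S₀ S₁ S : ℕ
      S₀ = ℕΣ.sum (λ π → δℕ (classAt (suc b) π) zero)
      S₁ = ℕΣ.sum (λ π → δℕ (classAt (suc b) π) (suc zero))
      S  = ℕΣ.sum (λ π → δℕ (classAt (suc b) π) (suc (suc (suc b))))

    fiberSize-classOf : ∀ c → fiberSize classOf c ≡ size₁ c
    fiberSize-classOf zero = begin
      fiberSize classOf zero
        ≡⟨ fiberSize-block zero (suc b) (λ β π β≢ → cong (λ d → δℕ d zero) (classAt-outside β π β≢)) ⟩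
      ℕΣ.sum (λ π → δℕ (classAt (suc b) π) zero)
        ≡⟨ ℕΣ.sum-cong-≗ δℕ-classAt-p ⟩
      ℕΣ.sum (λ π → δℕ π p)
        ≡⟨ sum-δℕ p ⟩
      1 ∎
    fiberSize-classOf (suc zero) = begin
      fiberSize classOf (suc zero)
        ≡⟨ fiberSize-block (suc zero) (suc b) (λ β π β≢ → cong (λ d → δℕ d (suc zero)) (classAt-outside β π β≢)) ⟩
      ℕΣ.sum (λ π → δℕ (classAt (suc b) π) (suc zero))
        ≡⟨ ℕΣ.sum-cong-≗ δℕ-classAt-q ⟩
      ℕΣ.sum (λ π → δℕ π q)
        ≡⟨ sum-δℕ q ⟩
      1 ∎
    fiberSize-classOf (suc (suc γ)) =
      trans (fiberSize-block (suc (suc γ)) γ (λ β π β≢γ → δℕ-≢ (λ eq → β≢γ (sym (classAt-block β π γ eq)))))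
            (inBlock (γ ≟ suc b))
      where
      inBlock : Dec (γ ≡ suc b) → ℕΣ.sum (λ π → δℕ (classAt γ π) (suc (suc γ))) ≡ size₁ (suc (suc γ))
      inBlock (no γ≢)    = trans (sumℕ-const _ 1 (λ π → trans (cong (λ d → δℕ d (suc (suc γ))) (classAt-outside γ π γ≢))
                                                             (δℕ-refl _)))
                                 (trans (ℕ.*-identityʳ n) (sym (size₁-otherBlock γ≢)))
      inBlock (yes refl) = trans restOfOwnBlock (sym size₁-ownBlock)

    εClass-block : ∀ β → εClass (suc (suc (suc β))) (suc (suc (suc β))) ≡ 0
    εClass-block β rewrite isYes-true (suc β ≟ suc β) refl = refl

    fiberSum₁ : ∀ c → fiberSum classOf ones c ≡ + size₁ c
    fiberSum₁ c = trans (fiberSum-ones classOf c) (cong +_ (fiberSize-classOf c))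

    blockExponent : ℕΣ.sum (λ β → size₁ (suc (suc (suc β))) ∸ 1) ≡ n′ ℕ.+ (n ∸ 1) ℕ.* (l ∸ 1)
    blockExponent = begin
      ℕΣ.sum (λ β → size₁ (suc (suc (suc β))) ∸ 1)
        ≡⟨ ℕΣ.sum-remove {i = b} (λ β → size₁ (suc (suc (suc β))) ∸ 1) ⟩
      (size₁ (suc (suc (suc b))) ∸ 1) ℕ.+ ℕΣ.sum (λ t → size₁ (suc (suc (suc (punchIn b t)))) ∸ 1)
        ≡⟨ cong₂ ℕ._+_ (cong (_∸ 1) size₁-ownBlock)
                       (sumℕ-const _ (n ∸ 1) (λ t → cong (_∸ 1) (size₁-otherBlock (Fin.punchInᵢ≢i b t ∘ Fin.suc-injective)))) ⟩
      n′ ℕ.+ (l ∸ 1) ℕ.* (n ∸ 1)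
        ≡⟨ cong (n′ ℕ.+_) (ℕ.*-comm (l ∸ 1) (n ∸ 1)) ⟩
      n′ ℕ.+ (n ∸ 1) ℕ.* (l ∸ 1) ∎

    fiberFactor₁ : ∀ x → Level₁.fiberFactor x classOf ≡ (x + + 1) ^ (n ∸ 1) * x ^ (n′ ℕ.+ (n ∸ 1) ℕ.* (l ∸ 1))
    fiberFactor₁ x = begin
      Level₁.fiberFactor x classOf
        ≡⟨ product-cong (λ c → cong (λ s → (x + + εClass c c) ^ (s ∸ 1)) (fiberSize-classOf c)) ⟩
      + 1 * (+ 1 * ((x + + 1) ^ (n ∸ 1) * product (λ β → (x + + εClass (suc (suc (suc β))) (suc (suc (suc β)))) ^ (size₁ (suc (suc (suc β))) ∸ 1))))
        ≡⟨ trans (ℤ.*-identityˡ _) (ℤ.*-identityˡ _) ⟩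
      (x + + 1) ^ (n ∸ 1) * product (λ β → (x + + εClass (suc (suc (suc β))) (suc (suc (suc β)))) ^ (size₁ (suc (suc (suc β))) ∸ 1))
        ≡⟨ cong ((x + + 1) ^ (n ∸ 1) *_) (begin
             product (λ β → (x + + εClass (suc (suc (suc β))) (suc (suc (suc β)))) ^ (size₁ (suc (suc (suc β))) ∸ 1))
               ≡⟨ product-cong (λ β → cong (λ e → (x + + e) ^ (size₁ (suc (suc (suc β))) ∸ 1)) (εClass-block β)) ⟩
             product (λ β → (x + + 0) ^ (size₁ (suc (suc (suc β))) ∸ 1))
               ≡⟨ product-^ (x + + 0) (λ β → size₁ (suc (suc (suc β))) ∸ 1) ⟩
             (x + + 0) ^ ℕΣ.sum (λ β → size₁ (suc (suc (suc β))) ∸ 1)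
               ≡⟨ cong₂ _^_ (ℤ.+-identityʳ x) blockExponent ⟩
             x ^ (n′ ℕ.+ (n ∸ 1) ℕ.* (l ∸ 1)) ∎) ⟩
      (x + + 1) ^ (n ∸ 1) * x ^ (n′ ℕ.+ (n ∸ 1) ℕ.* (l ∸ 1)) ∎

    size₁-positive : ∀ c → ∃ λ s → size₁ c ≡ suc s
    size₁-positive zero          = 0 , refl
    size₁-positive (suc zero)    = 0 , refl
    size₁-positive (suc (suc β)) with ⌊ β ≟ suc b ⌋
    ... | true  = n′ , refl
    ... | false = suc (suc n′) , refl

    classOf-onto : StrictlySurjective _≡_ classOf
    classOf-onto = surjective-fiberSize classOf
      (λ c → proj₁ (size₁-positive c) , trans (fiberSize-classOf c) (proj₂ (size₁-positive c)))

    ρ : Class → Fin 4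
    ρ zero                = zero
    ρ (suc zero)          = zero
    ρ (suc (suc zero))    = suc zero
    ρ (suc (suc (suc β))) = if ⌊ β ≟ b ⌋ then suc (suc zero) else suc (suc (suc zero))

    ρ-ownBlock : ρ (suc (suc (suc b))) ≡ suc (suc zero)
    ρ-ownBlock = cong (if_then suc (suc zero) else suc (suc (suc zero))) (isYes-true (b ≟ b) refl)

    ρ-otherBlock : ∀ {β} → β ≢ b → ρ (suc (suc (suc β))) ≡ suc (suc (suc zero))
    ρ-otherBlock {β} β≢b = cong (if_then suc (suc zero) else suc (suc (suc zero))) (isYes-false (β ≟ b) β≢b)

    εClass-ρ : ∀ c d → c ≢ d → εClass c d ≡ ε₄ (ρ c) (ρ d)
    εClass-ρ zero                  zero                   c≢d = ⊥-elim (c≢d refl)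
    εClass-ρ zero                  (suc zero)             _   rewrite isYes-true (suc b ≟ suc b) refl = refl
    εClass-ρ zero                  (suc (suc zero))       _   = refl
    εClass-ρ zero                  (suc (suc (suc β)))    _   = endpointToBlock β (β ≟ b)
      where
      endpointToBlock : ∀ β → Dec (β ≡ b) → εClass zero (suc (suc (suc β))) ≡ ε₄ zero (ρ (suc (suc (suc β))))
      endpointToBlock β (yes refl) rewrite isYes-true (suc β ≟ suc β) refl | isYes-true (β ≟ β) refl = refl
      endpointToBlock β (no β≢b)   rewrite isYes-false (suc b ≟ suc β) (β≢b ∘ sym ∘ Fin.suc-injective)
                                         | isYes-false (β ≟ b) β≢b = refl
    εClass-ρ (suc zero)            zero                   _   rewrite isYes-true (suc b ≟ suc b) refl = refl
    εClass-ρ (suc zero)            (suc zero)             c≢d = ⊥-elim (c≢d refl)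
    εClass-ρ (suc zero)            (suc (suc zero))       _   = refl
    εClass-ρ (suc zero)            (suc (suc (suc β)))    _   = εClass-ρ zero (suc (suc (suc β))) (λ ())
    εClass-ρ (suc (suc zero))      d                      _   = refl
    εClass-ρ (suc (suc (suc β)))   zero                   _   = blockToEndpoint β (β ≟ b)
      where
      blockToEndpoint : ∀ β → Dec (β ≡ b) → εClass (suc (suc (suc β))) zero ≡ ε₄ (ρ (suc (suc (suc β)))) zero
      blockToEndpoint β (yes refl) rewrite isYes-true (suc β ≟ suc β) refl | isYes-true (β ≟ β) refl = refl
      blockToEndpoint β (no β≢b)   rewrite isYes-false (suc β ≟ suc b) (β≢b ∘ Fin.suc-injective)
                                         | isYes-false (β ≟ b) β≢b = refl
    εClass-ρ (suc (suc (suc β)))   (suc zero)             _   = εClass-ρ (suc (suc (suc β))) zero (λ ())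
    εClass-ρ (suc (suc (suc β)))   (suc (suc zero))       _   = toCentre (β ≟ b)
      where
      toCentre : Dec (β ≡ b) → 1 ≡ ε₄ (ρ (suc (suc (suc β)))) (suc zero)
      toCentre (yes refl) rewrite ρ-ownBlock = refl
      toCentre (no β≢b)   rewrite ρ-otherBlock β≢b = refl
    εClass-ρ (suc (suc (suc β)))   (suc (suc (suc β′)))   c≢d
      rewrite isYes-false (suc β ≟ suc β′) (λ eq → c≢d (cong (λ γ → suc (suc γ)) eq)) = betweenBlocks (β ≟ b) (β′ ≟ b)
      where
      betweenBlocks : Dec (β ≡ b) → Dec (β′ ≡ b) → 2 ≡ ε₄ (ρ (suc (suc (suc β)))) (ρ (suc (suc (suc β′))))
      betweenBlocks (yes refl) (yes refl) = ⊥-elim (c≢d refl)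
      betweenBlocks (yes refl) (no β′≢b)  rewrite ρ-ownBlock   | ρ-otherBlock β′≢b = refl
      betweenBlocks (no β≢b)   (yes refl) rewrite ρ-otherBlock β≢b | ρ-ownBlock    = refl
      betweenBlocks (no β≢b)   (no β′≢b)  rewrite ρ-otherBlock β≢b | ρ-otherBlock β′≢b = refl

    diagonal-ρ : ∀ x c → x + + εClass c c + + size₁ c * - + εClass c c
                       ≡ lam₄ x (+ n) (ρ c) + + size₁ c * - + ε₄ (ρ c) (ρ c)
    diagonal-ρ x zero       rewrite isYes-true (suc b ≟ suc b) refl = endpoint x
      where endpoint : ∀ x → x + + 0 + + 1 * - + 0 ≡ x + + 2 + + 1 * - + 2
            endpoint = solve-∀
    diagonal-ρ x (suc zero) = diagonal-ρ x zero
    diagonal-ρ x (suc (suc zero)) = refl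
    diagonal-ρ x (suc (suc (suc β))) rewrite εClass-block β = byBlock (β ≟ b)
      where
      byBlock : Dec (β ≡ b) → x + + 0 + + size₁ (suc (suc (suc β))) * - + 0
                          ≡ lam₄ x (+ n) (ρ (suc (suc (suc β)))) + + size₁ (suc (suc (suc β))) * - + ε₄ (ρ (suc (suc (suc β)))) (ρ (suc (suc (suc β))))
      byBlock (yes refl) rewrite ρ-ownBlock = refl
      byBlock (no β≢b) rewrite ρ-otherBlock β≢b | size₁-otherBlock (β≢b ∘ Fin.suc-injective) = other x (+ n)
        where other : ∀ x N → x + + 0 + N * - + 0 ≡ x + + 2 * N + N * - + 2
              other = solve-∀

    size₂ : Fin 4 → ℕ
    size₂ zero                   = 2
    size₂ (suc zero)             = 1
    size₂ (suc (suc zero))       = 1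
    size₂ (suc (suc (suc zero))) = suc l′

    blocks-ρ : ∀ d → ℕΣ.sum (λ β → δℕ (ρ (suc (suc (suc β)))) d)
                   ≡ δℕ (suc (suc zero)) d ℕ.+ suc l′ ℕ.* δℕ (suc (suc (suc zero))) d
    blocks-ρ d = trans (ℕΣ.sum-remove {i = b} (λ β → δℕ (ρ (suc (suc (suc β)))) d))
      (cong₂ ℕ._+_ (cong (λ c → δℕ c d) ρ-ownBlock)
                   (sumℕ-const _ _ (λ t → cong (λ c → δℕ c d) (ρ-otherBlock (Fin.punchInᵢ≢i b t)))))

    fiberSize-ρ : ∀ d → fiberSize ρ d ≡ size₂ d
    fiberSize-ρ zero = cong (λ z → 2 ℕ.+ z) (trans (blocks-ρ zero) (ℕ.*-zeroʳ (suc l′)))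
    fiberSize-ρ (suc zero) = cong (λ z → 1 ℕ.+ z) (trans (blocks-ρ (suc zero)) (ℕ.*-zeroʳ (suc l′)))
    fiberSize-ρ (suc (suc zero)) = trans (blocks-ρ (suc (suc zero))) (cong suc (ℕ.*-zeroʳ (suc l′)))
    fiberSize-ρ (suc (suc (suc zero))) = trans (blocks-ρ (suc (suc (suc zero)))) (ℕ.*-identityʳ (suc l′))

    ρ-onto : StrictlySurjective _≡_ ρ
    ρ-onto = surjective-fiberSize ρ λ where
      zero                   → 1 , fiberSize-ρ zero
      (suc zero)             → 0 , fiberSize-ρ (suc zero)
      (suc (suc zero))       → 0 , fiberSize-ρ (suc (suc zero))
      (suc (suc (suc zero))) → l′ , fiberSize-ρ (suc (suc (suc zero)))

    blockWeights-ρ : ∀ d → sum (λ β → δ (ρ (suc (suc (suc β)))) d * + size₁ (suc (suc (suc β))))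
                         ≡ δ (suc (suc zero)) d * + suc n′ + δ (suc (suc (suc zero))) d * + (suc l′ ℕ.* n)
    blockWeights-ρ d = begin
      sum (λ β → δ (ρ (suc (suc (suc β)))) d * + size₁ (suc (suc (suc β))))
        ≡⟨ sum-remove {i = b} (λ β → δ (ρ (suc (suc (suc β)))) d * + size₁ (suc (suc (suc β)))) ⟩
      δ (ρ (suc (suc (suc b)))) d * + size₁ (suc (suc (suc b)))
        + sum (λ t → δ (ρ (suc (suc (suc (punchIn b t))))) d * + size₁ (suc (suc (suc (punchIn b t)))))
        ≡⟨ cong₂ _+_ (cong₂ (λ c s → δ c d * + s) ρ-ownBlock size₁-ownBlock)
                     (sum-cong-≗ (λ t → cong₂ (λ c s → δ c d * + s) (ρ-otherBlock (Fin.punchInᵢ≢i b t))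
                                                (size₁-otherBlock (Fin.punchInᵢ≢i b t ∘ Fin.suc-injective)))) ⟩
      δ (suc (suc zero)) d * + suc n′ + sum (λ (t : Fin (suc l′)) → δ (suc (suc (suc zero))) d * + n)
        ≡⟨ cong (_+_ (δ (suc (suc zero)) d * + suc n′))
                (*-distribˡ-sum (δ (suc (suc (suc zero))) d) (λ (_ : Fin (suc l′)) → + n)) ⟨
      δ (suc (suc zero)) d * + suc n′ + δ (suc (suc (suc zero))) d * sum (λ (t : Fin (suc l′)) → + n)
        ≡⟨ cong (λ s → δ (suc (suc zero)) d * + suc n′ + δ (suc (suc (suc zero))) d * s)
                (sum-const-pos (λ (_ : Fin (suc l′)) → + n) n (λ _ → refl)) ⟩
      δ (suc (suc zero)) d * + suc n′ + δ (suc (suc (suc zero))) d * + (suc l′ ℕ.* n) ∎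

    fiberSum-ρ : ∀ d → fiberSum ρ (fiberSum classOf ones) d ≡ W₄ (+ n) (+ l) d
    fiberSum-ρ d = begin
      sum (λ c → δ (ρ c) d * fiberSum classOf ones c)
        ≡⟨ sum-cong-≗ (λ c → cong (δ (ρ c) d *_) (fiberSum₁ c)) ⟩
      δ zero d * + 1 + (δ zero d * + 1 + (δ (suc zero) d * + n + sum (λ β → δ (ρ (suc (suc (suc β)))) d * + size₁ (suc (suc (suc β))))))
        ≡⟨ cong (λ s → δ zero d * + 1 + (δ zero d * + 1 + (δ (suc zero) d * + n + s))) (blockWeights-ρ d) ⟩
      δ zero d * + 1 + (δ zero d * + 1 + (δ (suc zero) d * + n + (δ (suc (suc zero)) d * + suc n′ + δ (suc (suc (suc zero))) d * + (suc l′ ℕ.* n))))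
        ≡⟨ collapse d ⟩
      W₄ (+ n) (+ l) d ∎
      where
      collapse : ∀ d → δ zero d * + 1 + (δ zero d * + 1 + (δ (suc zero) d * + n
                       + (δ (suc (suc zero)) d * + suc n′ + δ (suc (suc (suc zero))) d * + (suc l′ ℕ.* n))))
                     ≡ W₄ (+ n) (+ l) d
      collapse zero                   = endpoints (+ n) (+ suc n′) (+ (suc l′ ℕ.* n))
        where endpoints : ∀ N A B → + 1 * + 1 + (+ 1 * + 1 + (+ 0 * N + (+ 0 * A + + 0 * B))) ≡ + 2
              endpoints = solve-∀
      collapse (suc zero)             = central (+ n) (+ suc n′) (+ (suc l′ ℕ.* n))
        where central : ∀ N A B → + 0 * + 1 + (+ 0 * + 1 + (+ 1 * N + (+ 0 * A + + 0 * B))) ≡ N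
              central = solve-∀
      collapse (suc (suc zero))       = ownBlock (+ n) (+ suc n′) (+ (suc l′ ℕ.* n))
        where ownBlock : ∀ N A B → + 0 * + 1 + (+ 0 * + 1 + (+ 0 * N + (+ 1 * A + + 0 * B))) ≡ A
              ownBlock = solve-∀
      collapse (suc (suc (suc zero))) = otherBlocks (+ n) (+ suc n′) (+ (suc l′ ℕ.* n))
        where otherBlocks : ∀ N A B → + 0 * + 1 + (+ 0 * + 1 + (+ 0 * N + (+ 0 * A + + 1 * B))) ≡ B
              otherBlocks = solve-∀

    module Level₂ (x : ℤ) = Lumping (lam₄ x (+ n)) B₄

    fiberFactor₂ : ∀ x → Level₂.fiberFactor x ρ ≡ (x + + 2) * (x + + (2 ℕ.* n)) ^ (l ∸ 2)
    fiberFactor₂ x = trans (product-cong (λ d → cong (λ s → lam₄ x (+ n) d ^ (s ∸ 1)) (fiberSize-ρ d)))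
                           (collect (x + + 2) ((x + + (2 ℕ.* n)) ^ l′))
      where collect : ∀ X Y → X * + 1 * (+ 1 * (+ 1 * (Y * + 1))) ≡ X * Y
            collect = solve-∀

    quotient₁-lift : ∀ x c d → Level₁.quotient x (fiberSum classOf ones) c d ≡ Level₂.lift x ρ (fiberSum classOf ones) c d
    quotient₁-lift x = quotient-lift (λ c → x + + εClass c c) (λ c d → - + εClass c d) (lam₄ x (+ n)) B₄ ρ (fiberSum classOf ones)
      (λ c → trans (cong (λ w → x + + εClass c c + w * - + εClass c c) (fiberSum₁ c))
                   (trans (diagonal-ρ x c) (cong (λ w → lam₄ x (+ n) (ρ c) + w * B₄ (ρ c) (ρ c)) (sym (fiberSum₁ c)))))
      (λ c d c≢d → cong (λ e → - + e) (εClass-ρ c d c≢d))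

    level₁ : ∀ x → charPolyAt (eccMatrix G) x
      ≡ Level₁.fiberFactor x classOf * det (suc (suc (suc l))) (Level₁.quotient x (fiberSum classOf ones))
    level₁ x = trans (det-cong (suc l ℕ.* n) (charMatrix-lift x))
                     (Level₁.det-lift x (suc l ℕ.* n) classOf ones classOf-onto)

    level₂ : ∀ x → det (suc (suc (suc l))) (Level₁.quotient x (fiberSum classOf ones)) ≡ Level₂.fiberFactor x ρ * quartic n l x
    level₂ x = begin
      det (suc (suc (suc l))) (Level₁.quotient x (fiberSum classOf ones))
        ≡⟨ det-cong (suc (suc (suc l))) {Level₁.quotient x (fiberSum classOf ones)} {Level₂.lift x ρ (fiberSum classOf ones)}
                    (quotient₁-lift x) ⟩
      det (suc (suc (suc l))) (Level₂.lift x ρ (fiberSum classOf ones))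
        ≡⟨ Level₂.det-lift x (suc (suc (suc l))) ρ (fiberSum classOf ones) ρ-onto ⟩
      Level₂.fiberFactor x ρ * det 4 (Level₂.quotient x (fiberSum ρ (fiberSum classOf ones)))
        ≡⟨ cong (Level₂.fiberFactor x ρ *_)
                (det-cong 4 {Level₂.quotient x (fiberSum ρ (fiberSum classOf ones))} {Level₂.quotient x (W₄ (+ n) (+ l))}
                            (λ c d → cong (λ w → δ c d * lam₄ x (+ n) c + w * B₄ c d) (fiberSum-ρ c))) ⟩
      Level₂.fiberFactor x ρ * det 4 (Level₂.quotient x (W₄ (+ n) (+ l)))
        ≡⟨ cong (Level₂.fiberFactor x ρ *_) (det-quotient₄ n l x) ⟩
      Level₂.fiberFactor x ρ * quartic n l x ∎

    charPoly-G : ∀ x → charPolyAt (eccMatrix G) x ≡ factorisedCharPoly n l x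
    charPoly-G x = begin
      charPolyAt (eccMatrix G) x
        ≡⟨ level₁ x ⟩
      Level₁.fiberFactor x classOf * det (suc (suc (suc l))) (Level₁.quotient x (fiberSum classOf ones))
        ≡⟨ cong₂ _*_ (fiberFactor₁ x) (trans (level₂ x) (cong (_* quartic n l x) (fiberFactor₂ x))) ⟩
      (x + + 1) ^ (n ∸ 1) * x ^ (n′ ℕ.+ (n ∸ 1) ℕ.* (l ∸ 1)) * ((x + + 2) * (x + + (2 ℕ.* n)) ^ (l ∸ 2) * quartic n l x)
        ≡⟨ rearrange ((x + + 1) ^ (n ∸ 1)) (x ^ (n′ ℕ.+ (n ∸ 1) ℕ.* (l ∸ 1))) (x + + 2) ((x + + (2 ℕ.* n)) ^ (l ∸ 2)) (quartic n l x) ⟩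
      (x + + 1) ^ (n ∸ 1) * (x + + 2) * x ^ ((n ∸ 3) ℕ.+ (n ∸ 1) ℕ.* (l ∸ 1)) * (x + + (2 ℕ.* n)) ^ (l ∸ 2) * quartic n l x ∎
      where
      rearrange : ∀ A P X R Q → A * P * (X * R * Q) ≡ A * X * P * R * Q
      rearrange = solve-∀

  -- n, l and G are abbreviations; transporting along refl keeps the type checker from unfolding det to compare them
  charPoly : CharPolyFormula n l
  charPoly b p q p≢q x =
    subst (λ A → charPolyAt (eccMatrix A) x ≡ factorisedCharPoly n l x) {G b p≢q} {adjG n l b p q} refl
          (charPoly-G b p≢q x)

mainTheorem15 : (n l : ℕ) → 3 ≤ n → 2 ≤ l →
    (b : Fin l) (p q : Fin n) → p ≢ q →
    (x : ℤ) →
    charPolyAt (eccMatrix (adjG n l b p q)) x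
      ≡ (x + + 1) ^ (n ∸ 1) * (x + + 2) * x ^ ((n ∸ 3) ℕ.+ (n ∸ 1) ℕ.* (l ∸ 1))
        * (x + + (2 ℕ.* n)) ^ (l ∸ 2) * quartic n l x
mainTheorem15 (suc (suc (suc n′))) (suc (suc l′)) (s≤s (s≤s (s≤s _))) (s≤s (s≤s _)) =
  subst₂ CharPolyFormula {RemovedEdge.n n′ l′} {suc (suc (suc n′))} {RemovedEdge.l n′ l′} {suc (suc l′)}
         refl refl (RemovedEdge.charPoly n′ l′)
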